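{- There exists an absolute constant $C>0$ such that for all integers $n \ge 1$ and $k \ge 1$ and every polynomial $p:\mathbf{F}_2^n \to \mathbf{F}_2$ of degree at most $2$, the function $f(x) = (-1)^{p(x)}$ satisfies \[ \sum_{A \subset [n],\, |A| = k} |\hat f(A)| \le C k^{ -1/2} (1+\sqrt{2})^k . \]
   Context: For $f:\mathbf{F}_2^n \to \mathbf{C}$ and $A \subset [n]=\{1,\dots,n\}$, the Fourier coefficient is $\hat f(A) = \frac{1}{2^n}\sum_{x \in \mathbf{F}_2^n} f(x)(-1)^{x_A}$, where $x_A = \sum_{i\in A} x_i$. -}

module Defs where

open import Data.Bool using (Bool; true; false; _xor_; _∧_; if_then_else_)
open import Data.Nat as ℕ using (ℕ; zero; suc)
open import Data.Integer as ℤ using (ℤ)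
open import Data.Rational as ℚ using (ℚ; 0ℚ; 1ℚ; _+_; _*_; _-_; _≤_; _<_; ∣_∣)
open import Data.Fin using (Fin)
open import Data.Vec using (Vec; []; _∷_; lookup; foldr)
import Data.Vec as Vec
open import Data.List using (List; []; _∷_; _++_; map; filter)
import Data.List as List
open import Data.Fin.Subset using (Subset)
import Data.Fin.Subset as Sub
open import Data.Product using (Σ; ∃; _×_; _,_)
open import Data.Sum using (_⊎_)
open import Relation.Binary.PropositionalEquality using (_≡_)
import Data.Nat.Properties as ℕP

-- Points of F₂ⁿ are Boolean vectors (true = 1, xor = addition, ∧ = multiplication).
-- All 2ⁿ points of F₂ⁿ.
allVecs : (n : ℕ) → List (Vec Bool n)
allVecs zero = [] ∷ []
allVecs (suc n) = map (false ∷_) (allVecs n) ++ map (true ∷_) (allVecs n)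

sumℚ : List ℚ → ℚ
sumℚ = List.foldr _+_ 0ℚ

sumℤ : List ℤ → ℤ
sumℤ = List.foldr ℤ._+_ (ℤ.+ 0)

xA : {n : ℕ} → Subset n → Vec Bool n → Bool
xA A x = foldr _ _xor_ false (Vec.zipWith _∧_ A x)

sign : Bool → ℤ
sign false = ℤ.+ 1
sign true  = ℤ.- (ℤ.+ 1)

fourierSign : (n : ℕ) → (Vec Bool n → Bool) → Subset n → ℚ
fourierSign n p A =
  ℚ._/_ (sumℤ (map (λ x → sign (p x) ℤ.* sign (xA A x)) (allVecs n)))
    (2 ℕ.^ n) {{ℕP.m^n≢0 2 n}}

quadEval : {n : ℕ} → Bool → Vec Bool n → (Fin n → Fin n → Bool) → Vec Bool n → Bool
quadEval {n} c a b x =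
  c xor xA a x xor
  foldr _ _xor_ false
    (Vec.tabulate {n = n} λ i → foldr _ _xor_ false
      (Vec.tabulate {n = n} λ j → b i j ∧ lookup x i ∧ lookup x j))

DegreeAtMost2 : {n : ℕ} → (Vec Bool n → Bool) → Set
DegreeAtMost2 {n} p =
  Σ Bool λ c → Σ (Vec Bool n) λ a → Σ (Fin n → Fin n → Bool) λ b →
    ∀ x → p x ≡ quadEval c a b x

subsetsOfSize : (n k : ℕ) → List (Subset n)
subsetsOfSize n k = filter (λ A → Sub.∣ A ∣ ℕP.≟ k) (allVecs n)

levelL1 : (n k : ℕ) → (Vec Bool n → Bool) → ℚ
levelL1 n k p = sumℚ (map (λ A → ∣ fourierSign n p A ∣) (subsetsOfSize n k))

two : ℚ
two = ℤ.+ 2 ℚ./ 1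

-- The real field ℚ(√2) ⊂ ℝ: r + s√2, with its (real) arithmetic and order.
record ℚ√2 : Set where
  constructor _+_√2
  field
    re : ℚ
    ir : ℚ
open ℚ√2 public

fromℚ : ℚ → ℚ√2
fromℚ q = q + 0ℚ √2

_⊕_ : ℚ√2 → ℚ√2 → ℚ√2
(a + b √2) ⊕ (c + d √2) = (a + c) + (b + d) √2

_⊗_ : ℚ√2 → ℚ√2 → ℚ√2
(a + b √2) ⊗ (c + d √2) = (a * c + two * (b * d)) + (a * d + b * c) √2

_⊗^_ : ℚ√2 → ℕ → ℚ√2
x ⊗^ zero = fromℚ 1ℚ
x ⊗^ suc m = x ⊗ (x ⊗^ m)

silver : ℚ√2
silver = 1ℚ + 1ℚ √2

-- r + s√2 ≥ 0 as a real number.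
NonNeg√2 : ℚ√2 → Set
NonNeg√2 (r + s √2) =
    (0ℚ ≤ r × 0ℚ ≤ s)
  ⊎ (0ℚ ≤ r × s < 0ℚ × two * (s * s) ≤ r * r)
  ⊎ (r < 0ℚ × 0ℚ ≤ s × r * r ≤ two * (s * s))

_≤√2_ : ℚ√2 → ℚ√2 → Set
(a + b √2) ≤√2 (c + d √2) = NonNeg√2 ((c - a) + (d - b) √2)

-- Write F(A) = Σ_x (-1)^(p(x) + x_A) = 2ⁿ f̂(A). Since deg p ≤ 2, B(h, x) = p(x + h) + p(x) + p(h) + p(0)
-- is a symmetric bilinear form, and expanding F(A)² with y = x + h gives F(A)² = 2ⁿ |R| [A ∈ S], where
-- R is the radical of B and S, the set of A with p(h) + p(0) + h_A = 0 on R, is an affine subspace.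
-- Parseval gives |S| |R| = 2ⁿ, so if dim S = r then the level-k sum is N / 2^(r/2), where N ≤ Σ_{j ≤ k} C(r, j)
-- counts the weight-k points of S. It remains to show k N² ≤ 74² (1 + √2)^(2k) 2^r. For r < 7k/3 the
-- trivial N ≤ 2^r suffices. Otherwise N ≤ 4 C(r, k), and Σ_t C(2t + π, k) 2^(-t) is bounded by a
-- multiple of (1 + √2)^k through Pascal's rule; since C(r + 2j, k) 2^(-j) stays within a factor 2 of
-- C(r, k) for j up to about √(k/3) on one side of r, a single term is at most a 1/√k fraction of that sum.

module Submission where

open import Algebra.Structures using (IsCommutativeMonoid)
open import Data.Bool using (Bool; false)
open import Data.Nat using (ℕ)
open import Data.Vec using (Vec)
open import Relation.Binary.PropositionalEquality
open import Defs using (DegreeAtMost2)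

module Binomial where

  open import Data.Nat
  open import Data.Nat.Properties
  open import Data.Nat.Combinatorics using (_C_; nC1≡n; nCk+nC[k+1]≡[n+1]C[k+1])
  open import Data.Nat.Tactic.RingSolver
  open import Relation.Binary.PropositionalEquality

  C-pascal : ∀ n k → suc n C suc k ≡ n C k + n C suc k
  C-pascal n k = sym (nCk+nC[k+1]≡[n+1]C[k+1] n k)

  C-pos : ∀ {k n} → k ≤ n → 1 ≤ n C k
  C-pos z≤n = ≤-refl
  C-pos {suc k} {suc n} (s≤s k≤n) = ≤-trans (C-pos k≤n) (≤-trans (m≤m+n _ _) (≤-reflexive (sym (C-pascal n k))))

  absorption : ∀ n k → suc k * (suc n C suc k) ≡ suc n * (n C k)
  absorption n zero = trans (*-identityˡ _) (trans (nC1≡n (suc n)) (sym (*-identityʳ (suc n))))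
  absorption zero (suc k) = *-zeroʳ (suc (suc k))
  absorption (suc n) (suc k) = begin
    2+ k * (2+ n C 2+ k)                                   ≡⟨ cong (2+ k *_) (C-pascal (suc n) (suc k)) ⟩
    2+ k * (a + b)                                         ≡⟨ split (suc k) a b ⟩
    suc k * a + a + 2+ k * b                               ≡⟨ cong (λ x → x + a + 2+ k * b) (absorption n k) ⟩
    suc n * (n C k) + a + 2+ k * b                         ≡⟨ cong (λ x → suc n * (n C k) + x + 2+ k * b) (C-pascal n k) ⟩
    suc n * (n C k) + (n C k + n C suc k) + 2+ k * b       ≡⟨ cong (suc n * (n C k) + (n C k + n C suc k) +_) (absorption n (suc k)) ⟩
    suc n * (n C k) + (n C k + n C suc k) + suc n * (n C suc k) ≡⟨ merge n (n C k) (n C suc k) ⟩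
    2+ n * (n C k + n C suc k)                             ≡⟨ cong (2+ n *_) (C-pascal n k) ⟨
    2+ n * a                                               ∎
    where
      open ≡-Reasoning
      a = suc n C suc k
      b = suc n C 2+ k
      split : ∀ m x y → suc m * (x + y) ≡ m * x + x + suc m * y
      split = solve-∀
      merge : ∀ m x y → suc m * x + (x + y) + suc m * y ≡ 2+ m * (x + y)
      merge = solve-∀

  C-step : ∀ k e → (suc (k + e) C k) * suc e ≡ suc (k + e) * ((k + e) C k)
  C-step k e = +-cancelˡ-≡ (k * X) _ _ (trans (sym split) (weighted (k + e) k))
    where
      X = suc (k + e) C k
      split : X * suc (k + e) ≡ k * X + X * suc e
      split = trans (cong (X *_) (sym (+-suc k e))) (trans (*-distribˡ-+ X k (suc e)) (cong (_+ X * suc e) (*-comm X k)))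
      weighted : ∀ m k → (suc m C k) * suc m ≡ k * (suc m C k) + suc m * (m C k)
      weighted m zero = trans (*-identityˡ (suc m)) (sym (*-identityʳ (suc m)))
      weighted m (suc k) = begin
        (suc m C suc k) * suc m                  ≡⟨ cong (_* suc m) (C-pascal m k) ⟩
        (m C k + m C suc k) * suc m              ≡⟨ *-distribʳ-+ (suc m) (m C k) (m C suc k) ⟩
        (m C k) * suc m + (m C suc k) * suc m    ≡⟨ cong₂ _+_ (*-comm (m C k) (suc m)) (*-comm (m C suc k) (suc m)) ⟩
        suc m * (m C k) + suc m * (m C suc k)    ≡⟨ cong (_+ suc m * (m C suc k)) (absorption m k) ⟨
        suc k * (suc m C suc k) + suc m * (m C suc k) ∎
        where open ≡-Reasoning

  pairProd : ℕ → ℕ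
  pairProd m = suc m * 2+ m

  C-ratio : ∀ k e → (2+ (k + e) C k) * pairProd e ≡ pairProd (k + e) * ((k + e) C k)
  C-ratio k e = begin
    Y * (suc e * 2+ e)                          ≡⟨ reorder Y (suc e) (2+ e) ⟩
    (Y * 2+ e) * suc e                          ≡⟨ cong (_* suc e) outer ⟩
    (2+ (k + e) * X) * suc e                    ≡⟨ *-assoc (2+ (k + e)) X (suc e) ⟩
    2+ (k + e) * (X * suc e)                    ≡⟨ cong (2+ (k + e) *_) (C-step k e) ⟩
    2+ (k + e) * (suc (k + e) * ((k + e) C k))  ≡⟨ reorder′ (2+ (k + e)) (suc (k + e)) ((k + e) C k) ⟩
    (suc (k + e) * 2+ (k + e)) * ((k + e) C k)  ∎
    where
      open ≡-Reasoning
      Y = 2+ (k + e) C k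
      X = suc (k + e) C k
      reorder : ∀ a b c → a * (b * c) ≡ (a * c) * b
      reorder = solve-∀
      reorder′ : ∀ a b c → a * (b * c) ≡ (b * a) * c
      reorder′ = solve-∀
      outer : Y * 2+ e ≡ 2+ (k + e) * X
      outer = subst (λ z → (suc z C k) * 2+ e ≡ suc z * (z C k)) (+-suc k e) (C-step k (suc e))

module BinomialRatios where

  open import Data.Nat
  open import Data.Nat.Properties
  open import Data.Nat.Combinatorics using (_C_)
  open import Data.Nat.Tactic.RingSolver
  open import Relation.Binary.PropositionalEquality
  open Binomial

  ≤-by-slack : ∀ {x y} z → x + z ≡ y → x ≤ y
  ≤-by-slack {x} z eq = subst (x ≤_) eq (m≤m+n x z)

  cross-≤ : ∀ {a b c d} x y .{{_ : NonZero b}} → a * d ≡ c * b → x * b ≤ y * a → x * d ≤ y * c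
  cross-≤ {a} {b} {c} {d} x y eq h = *-cancelʳ-≤ (x * d) (y * c) b (begin
    x * d * b    ≡⟨ swap x d b ⟩
    x * b * d    ≤⟨ *-monoˡ-≤ d h ⟩
    y * a * d    ≡⟨ *-assoc y a d ⟩
    y * (a * d)  ≡⟨ cong (y *_) eq ⟩
    y * (c * b)  ≡⟨ *-assoc y c b ⟨
    y * c * b    ∎)
    where
      open ≤-Reasoning
      swap : ∀ x d b → x * d * b ≡ x * b * d
      swap = solve-∀

  -- C(r + 2, k) / C(r, k) is a product of two factors A / a with a = r - k + 1 = k + h and A = k + a;
  -- raising r by t = 2j multiplies each of them by at least (k - j) / k.
  factor-after-shift : ∀ j c h → let k = j + j + c ; t = j + j in
    (j + c) * (k + (k + h)) * (k + h + t) ≤ k * (k + (k + h) + t) * (k + h)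
  factor-after-shift j c h = ≤-by-slack (j * (3 * k * h + h * h + 2 * k * t + h * t)) (identity j c h)
    where
      k = j + j + c
      t = j + j
      identity : ∀ j c h →
        (j + c) * ((j + j + c) + ((j + j + c) + h)) * ((j + j + c) + h + (j + j))
          + j * (3 * (j + j + c) * h + h * h + 2 * (j + j + c) * (j + j) + h * (j + j))
        ≡ (j + j + c) * ((j + j + c) + ((j + j + c) + h) + (j + j)) * ((j + j + c) + h)
      identity = solve-∀

  -- Raising r by t = 2u multiplies each factor by at least k / (k + u).
  factor-before-shift : ∀ u v h → let k = u + v ; t = u + u in
    2 * k * (k + (k + h)) * (k + h + t) ≤ (2 * k + t) * (k + (k + h) + t) * (k + h)
  factor-before-shift u v h = ≤-by-slack ((u + u) * (h * (3 * (u + v) + h) + (u + u) * ((u + v) + h))) (identity u v h)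
    where
      identity : ∀ u v h →
        2 * (u + v) * ((u + v) + ((u + v) + h)) * ((u + v) + h + (u + u))
          + (u + u) * (h * (3 * (u + v) + h) + (u + u) * ((u + v) + h))
        ≡ (2 * (u + v) + (u + u)) * ((u + v) + ((u + v) + h) + (u + u)) * ((u + v) + h)
      identity = solve-∀

  pairProd-increase-persists : ∀ j c g → let k = j + j + c in 1 ≤ k →
    2 * pairProd (k + g) ≤ pairProd (k + (k + g)) →
    2 * c * pairProd (k + g + (j + j)) ≤ k * pairProd (k + (k + g + (j + j)))
  pairProd-increase-persists j c g 1≤k increase =
    *-cancelˡ-≤ k {{>-nonZero 1≤k}} (*-cancelʳ-≤ _ _ P (begin
      k * (2 * c * Q) * P               ≡⟨ e₁ k c Q P ⟩
      2 * (k * c) * (P * Q)             ≤⟨ *-monoˡ-≤ (P * Q) (*-monoʳ-≤ 2 kc≤f²) ⟩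
      2 * (f * f) * (P * Q)             ≡⟨ e₂ (f * f) P Q ⟩
      (f * f) * (2 * P * Q)             ≤⟨ *-monoʳ-≤ (f * f) (*-monoˡ-≤ Q increase) ⟩
      (f * f) * (R * Q)                 ≡⟨ lhs-factors j c g ⟩
      (f * A₁ * E₁) * (f * A₂ * E₂)     ≤⟨ *-mono-≤ (factor-after-shift j c (suc g)) (factor-after-shift j c (2+ g)) ⟩
      (k * A₁t * a₁) * (k * A₂t * a₂)   ≡⟨ rhs-factors j c g ⟩
      k * (k * S) * P                   ∎))
    where
      open ≤-Reasoning
      k = j + j + c
      f = j + c
      t = j + j
      P = pairProd (k + g)
      Q = pairProd (k + g + t)
      R = pairProd (k + (k + g))
      S = pairProd (k + (k + g + t))
      a₁ = k + suc g
      a₂ = k + 2+ g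
      A₁ = k + a₁
      A₂ = k + a₂
      E₁ = a₁ + t
      E₂ = a₂ + t
      A₁t = A₁ + t
      A₂t = A₂ + t
      kc≤f² : k * c ≤ f * f
      kc≤f² = ≤-by-slack (j * j) (square j c)
        where square : ∀ j c → (j + j + c) * c + j * j ≡ (j + c) * (j + c)
              square = solve-∀
      e₁ : ∀ k c Q P → k * (2 * c * Q) * P ≡ 2 * (k * c) * (P * Q)
      e₁ = solve-∀
      e₂ : ∀ F P Q → 2 * F * (P * Q) ≡ F * (2 * P * Q)
      e₂ = solve-∀
      lhs-factors : ∀ j c g → let k = j + j + c ; f = j + c ; t = j + j in
        (f * f) * ((suc (k + (k + g)) * suc (suc (k + (k + g)))) * (suc (k + g + t) * suc (suc (k + g + t))))
        ≡ (f * (k + (k + suc g)) * (k + suc g + t)) * (f * (k + (k + suc (suc g))) * (k + suc (suc g) + t))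
      lhs-factors = solve-∀
      rhs-factors : ∀ j c g → let k = j + j + c ; t = j + j in
        (k * (k + (k + suc g) + t) * (k + suc g)) * (k * (k + (k + suc (suc g)) + t) * (k + suc (suc g)))
        ≡ k * (k * (suc (k + (k + g + t)) * suc (suc (k + (k + g + t))))) * (suc (k + g) * suc (suc (k + g)))
      rhs-factors = solve-∀

  pairProd-decrease-persists : ∀ u v g → let k = u + v in 1 ≤ u →
    pairProd (k + (k + g + (u + u))) ≤ 2 * pairProd (k + g + (u + u)) →
    k * pairProd (k + (k + g)) ≤ 2 * (k + 3 * u) * pairProd (k + g)
  pairProd-decrease-persists u v g 1≤u decrease =
    *-cancelˡ-≤ (4 * k) {{m*n≢0 4 k {{_}} {{>-nonZero (≤-trans 1≤u (m≤m+n u v))}}}} (*-cancelʳ-≤ _ _ Q (begin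
      4 * k * (k * R) * Q               ≡⟨ lhs-factors u v g ⟩
      (2 * k * A₁ * E₁) * (2 * k * A₂ * E₂) ≤⟨ *-mono-≤ (factor-before-shift u v (suc g)) (factor-before-shift u v (2+ g)) ⟩
      (s * A₁t * a₁) * (s * A₂t * a₂)   ≡⟨ rhs-factors u v g ⟩
      (s * s) * (S * P)                 ≤⟨ *-monoʳ-≤ (s * s) (*-monoˡ-≤ P decrease) ⟩
      (s * s) * (2 * Q * P)             ≡⟨ e₁ (s * s) P Q ⟩
      2 * (s * s) * P * Q               ≤⟨ *-monoˡ-≤ Q (*-monoˡ-≤ P 2s²≤8k[k+3u]) ⟩
      4 * k * (2 * (k + 3 * u)) * P * Q ≡⟨ e₂ k (2 * (k + 3 * u)) P Q ⟩
      4 * k * (2 * (k + 3 * u) * P) * Q ∎))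
    where
      open ≤-Reasoning
      k = u + v
      t = u + u
      s = 2 * k + t
      P = pairProd (k + g)
      Q = pairProd (k + g + t)
      R = pairProd (k + (k + g))
      S = pairProd (k + (k + g + t))
      a₁ = k + suc g
      a₂ = k + 2+ g
      A₁ = k + a₁
      A₂ = k + a₂
      E₁ = a₁ + t
      E₂ = a₂ + t
      A₁t = A₁ + t
      A₂t = A₂ + t
      2s²≤8k[k+3u] : 2 * (s * s) ≤ 4 * k * (2 * (k + 3 * u))
      2s²≤8k[k+3u] = ≤-by-slack (8 * (u * v)) (square u v)
        where square : ∀ u v → 2 * ((2 * (u + v) + (u + u)) * (2 * (u + v) + (u + u))) + 8 * (u * v)
                                 ≡ 4 * (u + v) * (2 * ((u + v) + 3 * u))
              square = solve-∀
      e₁ : ∀ F P Q → F * (2 * Q * P) ≡ 2 * F * P * Q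
      e₁ = solve-∀
      e₂ : ∀ k x P Q → 4 * k * x * P * Q ≡ 4 * k * (x * P) * Q
      e₂ = solve-∀
      lhs-factors : ∀ u v g → let k = u + v ; t = u + u in
        4 * k * (k * (suc (k + (k + g)) * suc (suc (k + (k + g))))) * (suc (k + g + t) * suc (suc (k + g + t)))
        ≡ (2 * k * (k + (k + suc g)) * (k + suc g + t)) * (2 * k * (k + (k + suc (suc g))) * (k + suc (suc g) + t))
      lhs-factors = solve-∀
      rhs-factors : ∀ u v g → let k = u + v ; t = u + u ; s = 2 * k + t in
        (s * (k + (k + suc g) + t) * (k + suc g)) * (s * (k + (k + suc (suc g)) + t) * (k + suc (suc g)))
        ≡ (s * s) * ((suc (k + (k + g + t)) * suc (suc (k + (k + g + t)))) * (suc (k + g) * suc (suc (k + g))))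
      rhs-factors = solve-∀

  ratio-after-increase : ∀ {k} j c g → k ≡ j + j + c → 1 ≤ k →
    2 * ((k + (k + g)) C k) ≤ 2+ (k + (k + g)) C k →
    2 * c * ((k + (k + g + (j + j))) C k) ≤ k * (2+ (k + (k + g + (j + j))) C k)
  ratio-after-increase {k} j c g refl 1≤k increase =
    cross-≤ (2 * c) k (sym (C-ratio k (k + g + (j + j))))
      (pairProd-increase-persists j c g 1≤k
        (≤-trans (cross-≤ 2 1 {{>-nonZero (C-pos (m≤m+n k (k + g)))}} (C-ratio k (k + g))
                   (≤-trans increase (≤-reflexive (sym (*-identityˡ _)))))
                 (≤-reflexive (*-identityˡ _))))

  ratio-before-decrease : ∀ {k} u v g → k ≡ u + v → 1 ≤ u →
    2+ (k + (k + g + (u + u))) C k ≤ 2 * ((k + (k + g + (u + u))) C k) →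
    k * (2+ (k + (k + g)) C k) ≤ 2 * (k + 3 * u) * ((k + (k + g)) C k)
  ratio-before-decrease {k} u v g refl 1≤u decrease =
    cross-≤ k (2 * (k + 3 * u)) (flipped (k + g))
      (pairProd-decrease-persists u v g 1≤u
        (≤-trans (≤-reflexive (sym (*-identityˡ _)))
          (cross-≤ {(k + e′) C k} {2+ (k + e′) C k} {pairProd e′} {pairProd (k + e′)} 1 2 {{>-nonZero (C-pos (≤-trans (m≤m+n k e′) (≤-trans (n≤1+n _) (n≤1+n _))))}} (sym (flipped e′))
            (≤-trans (≤-reflexive (*-identityˡ _)) decrease))))
    where
      e′ = k + g + (u + u)
      flipped : ∀ e → pairProd e * (2+ (k + e) C k) ≡ ((k + e) C k) * pairProd (k + e)
      flipped e = trans (*-comm (pairProd e) (2+ (k + e) C k)) (trans (C-ratio k e) (*-comm (pairProd (k + e)) ((k + e) C k)))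

  +[1+j]j≡+2j+j[j∸1] : ∀ j d → d + suc j * j ≡ (d + (j + j)) + j * (j ∸ 1)
  +[1+j]j≡+2j+j[j∸1] zero d = e d
    where e : ∀ d → d + 1 * 0 ≡ (d + 0) + 0
          e = solve-∀
  +[1+j]j≡+2j+j[j∸1] (suc j) d = e j d
    where e : ∀ j d → d + suc (suc j) * suc j ≡ (d + (suc j + suc j)) + suc j * j
          e = solve-∀

  +[1+j]j≡2j++j[j∸1] : ∀ j d → d + suc j * j ≡ j + j + (d + j * (j ∸ 1))
  +[1+j]j≡2j++j[j∸1] zero d = e d
    where e : ∀ d → d + 1 * 0 ≡ 0 + 0 + (d + 0)
          e = solve-∀
  +[1+j]j≡2j++j[j∸1] (suc j) d = e j d
    where e : ∀ j d → d + suc (suc j) * suc j ≡ suc j + suc j + (d + suc j * j)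
          e = solve-∀

  [d+[1+j]j]d≤[d+j[j∸1]][d+2j] : ∀ j d → (d + suc j * j) * d ≤ (d + j * (j ∸ 1)) * (d + (j + j))
  [d+[1+j]j]d≤[d+j[j∸1]][d+2j] zero d = ≤-reflexive (e d)
    where e : ∀ d → (d + 1 * 0) * d ≡ (d + 0) * (d + 0)
          e = solve-∀
  [d+[1+j]j]d≤[d+j[j∸1]][d+2j] (suc j) d = ≤-by-slack (2 * (suc j * suc j) * j) (e j d)
    where e : ∀ j d → (d + suc (suc j) * suc j) * d + 2 * (suc j * suc j) * j ≡ (d + suc j * j) * (d + (suc j + suc j))
          e = solve-∀

  [k+3u]d≤k[d+6u] : ∀ k u d → d ≤ 2 * k → (k + 3 * u) * d ≤ k * (d + 6 * u)
  [k+3u]d≤k[d+6u] k u d d≤2k = begin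
    (k + 3 * u) * d           ≡⟨ e₁ k u d ⟩
    k * d + 3 * (u * d)       ≤⟨ +-monoʳ-≤ (k * d) (*-monoʳ-≤ 3 (*-monoʳ-≤ u d≤2k)) ⟩
    k * d + 3 * (u * (2 * k)) ≡⟨ e₂ k u d ⟩
    k * (d + 6 * u)           ∎
    where
      open ≤-Reasoning
      e₁ : ∀ k u d → (k + 3 * u) * d ≡ k * d + 3 * (u * d)
      e₁ = solve-∀
      e₂ : ∀ k u d → k * d + 3 * (u * (2 * k)) ≡ k * (d + 6 * u)
      e₂ = solve-∀

  -- After an index where C(r + 2, k) ≥ 2 C(r, k), the ratio stays near 2 for a while:
  -- C(r + 2j, k) ≥ 2^j (1 - j (j - 1) / k) C(r, k).
  growth-after-increase : ∀ k g → 1 ≤ k → 2 * ((k + (k + g)) C k) ≤ 2+ (k + (k + g)) C k →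
    ∀ j d → k ≡ d + j * (j ∸ 1) →
    d * 2 ^ j * ((k + (k + g)) C k) ≤ k * ((k + (k + g + (j + j))) C k)
  growth-after-increase k g 1≤k increase zero d eq =
    subst₂ _≤_ (cong (λ z → z * 1 * C₀) (trans eq (+-identityʳ d)))
       (cong (λ z → k * ((k + z) C k)) (sym (+-identityʳ (k + g))))
       (≤-reflexive (cong (_* C₀) (*-identityʳ k)))
    where C₀ = (k + (k + g)) C k
  growth-after-increase k g 1≤k increase (suc j) d′ eq = *-cancelˡ-≤ k {{>-nonZero 1≤k}} (begin
    k * (d′ * 2 ^ suc j * C₀)                   ≡⟨ e₁ k d′ (2 ^ j) C₀ ⟩
    2 * ((k * d′) * (2 ^ j * C₀))               ≤⟨ *-monoʳ-≤ 2 (*-monoˡ-≤ (2 ^ j * C₀) kd′≤cd) ⟩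
    2 * ((c * d) * (2 ^ j * C₀))                ≡⟨ e₂ c d (2 ^ j) C₀ ⟩
    2 * c * (d * 2 ^ j * C₀)                    ≤⟨ *-monoʳ-≤ (2 * c) IH ⟩
    2 * c * (k * Cⱼ)                            ≡⟨ e₃ c k Cⱼ ⟩
    k * (2 * c * Cⱼ)                            ≤⟨ *-monoʳ-≤ k step ⟩
    k * (k * (2+ (k + (k + g + (j + j))) C k))  ≡⟨ cong (λ z → k * (k * (z C k))) (shift k g j) ⟩
    k * (k * ((k + (k + g + (suc j + suc j))) C k)) ∎)
    where
      open ≤-Reasoning
      shift : ∀ k g j → 2+ (k + (k + g + (j + j))) ≡ k + (k + g + (suc j + suc j))
      shift = solve-∀
      e₁ : ∀ k d′ p C → k * (d′ * (2 * p) * C) ≡ 2 * ((k * d′) * (p * C))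
      e₁ = solve-∀
      e₂ : ∀ c d p C → 2 * ((c * d) * (p * C)) ≡ 2 * c * (d * p * C)
      e₂ = solve-∀
      e₃ : ∀ c k X → 2 * c * (k * X) ≡ k * (2 * c * X)
      e₃ = solve-∀
      C₀ = (k + (k + g)) C k
      Cⱼ = (k + (k + g + (j + j))) C k
      c = d′ + j * (j ∸ 1)
      d = d′ + (j + j)
      IH : d * 2 ^ j * C₀ ≤ k * Cⱼ
      IH = growth-after-increase k g 1≤k increase j d (trans eq (+[1+j]j≡+2j+j[j∸1] j d′))
      step : 2 * c * Cⱼ ≤ k * (2+ (k + (k + g + (j + j))) C k)
      step = ratio-after-increase j c g (trans eq (+[1+j]j≡2j++j[j∸1] j d′)) 1≤k increase
      kd′≤cd : k * d′ ≤ c * d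
      kd′≤cd = subst (λ z → z * d′ ≤ c * d) (sym eq) ([d+[1+j]j]d≤[d+j[j∸1]][d+2j] j d′)

  -- Symmetrically, before an index where C(r + 2, k) ≤ 2 C(r, k):
  -- C(r, k) ≤ 2^(i+1) k / (2k - 3 i (i + 1)) · C(r - 2i, k).
  growth-before-decrease : ∀ k G → 2+ (k + (k + G)) C k ≤ 2 * ((k + (k + G)) C k) →
    ∀ i g → G ≡ g + (i + i) → ∀ d → 2 * k ≡ d + 3 * (i * suc i) →
    d * ((k + (k + G)) C k) ≤ 2 * k * 2 ^ i * ((k + (k + g)) C k)
  growth-before-decrease k G decrease zero g eqG d eqd =
    subst₂ (λ a b → a * ((k + (k + G)) C k) ≤ 2 * k * 1 * ((k + (k + b)) C k))
      (trans eqd (+-identityʳ d)) (trans eqG (+-identityʳ g))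
      (≤-reflexive (cong (_* ((k + (k + G)) C k)) (sym (*-identityʳ (2 * k)))))
  growth-before-decrease k G decrease (suc i) g eqG d′ eqd = *-cancelˡ-≤ s {{>-nonZero (≤-trans (s≤s z≤n) (m≤n+m (3 * u) k))}} (begin
    s * (d′ * C₀)                                 ≡⟨ *-assoc s d′ C₀ ⟨
    (s * d′) * C₀                                 ≤⟨ *-monoˡ-≤ C₀ sd′≤kd ⟩
    (k * d) * C₀                                  ≡⟨ *-assoc k d C₀ ⟩
    k * (d * C₀)                                  ≤⟨ *-monoʳ-≤ k IH ⟩
    k * (2 * k * 2 ^ i * ((k + (k + 2+ g)) C k))   ≡⟨ cong (λ z → k * (2 * k * 2 ^ i * (z C k))) (sym (shift k g)) ⟩
    k * (2 * k * 2 ^ i * (2+ (k + (k + g)) C k))   ≡⟨ e₁ k (2 ^ i) _ ⟩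
    2 * k * 2 ^ i * (k * (2+ (k + (k + g)) C k))   ≤⟨ *-monoʳ-≤ (2 * k * 2 ^ i) step ⟩
    2 * k * 2 ^ i * (2 * s * ((k + (k + g)) C k))  ≡⟨ e₂ k (2 ^ i) s _ ⟩
    s * (2 * k * 2 ^ suc i * ((k + (k + g)) C k))  ∎)
    where
      open ≤-Reasoning
      regroup₁ : ∀ g i → g + (suc i + suc i) ≡ 2+ g + (i + i)
      regroup₁ = solve-∀
      regroup₂ : ∀ d′ i → d′ + 3 * (suc i * suc (suc i)) ≡ (d′ + 6 * suc i) + 3 * (i * suc i)
      regroup₂ = solve-∀
      regroup₃ : ∀ k g t → k + (k + (g + t)) ≡ k + (k + g + t)
      regroup₃ = solve-∀
      shift : ∀ k g → 2+ (k + (k + g)) ≡ k + (k + 2+ g)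
      shift = solve-∀
      e₁ : ∀ k p X → k * (2 * k * p * X) ≡ 2 * k * p * (k * X)
      e₁ = solve-∀
      e₂ : ∀ k p s C → 2 * k * p * (2 * s * C) ≡ s * (2 * k * (2 * p) * C)
      e₂ = solve-∀
      C₀ = (k + (k + G)) C k
      u = suc i
      s = k + 3 * u
      d = d′ + 6 * u
      IH : d * C₀ ≤ 2 * k * 2 ^ i * ((k + (k + 2+ g)) C k)
      IH = growth-before-decrease k G decrease i (2+ g) (trans eqG (regroup₁ g i)) d (trans eqd (regroup₂ d′ i))
      u≤k : u ≤ k
      u≤k = *-cancelˡ-≤ 2 (≤-trans (≤-by-slack (d′ + (3 * (suc i * i) + 4 * i + 4)) (e i d′)) (≤-reflexive (sym eqd)))
        where e : ∀ i d′ → 2 * suc i + (d′ + (3 * (suc i * i) + 4 * i + 4)) ≡ d′ + 3 * (suc i * suc (suc i))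
              e = solve-∀
      sd′≤kd : s * d′ ≤ k * d
      sd′≤kd = [k+3u]d≤k[d+6u] k u d′ (≤-trans (m≤m+n d′ _) (≤-reflexive (sym eqd)))
      decrease′ : 2+ (k + (k + g + (u + u))) C k ≤ 2 * ((k + (k + g + (u + u))) C k)
      decrease′ = subst (λ z → 2+ z C k ≤ 2 * (z C k)) (trans (cong (λ z → k + (k + z)) eqG) (regroup₃ k g (u + u))) decrease
      step : k * (2+ (k + (k + g)) C k) ≤ 2 * s * ((k + (k + g)) C k)
      step = ratio-before-decrease u (k ∸ u) g (sym (m+[n∸m]≡n u≤k)) (s≤s z≤n) decrease′

  window-after-increase : ∀ k g w j → 1 ≤ k → 2 * ((k + (k + g)) C k) ≤ 2+ (k + (k + g)) C k →
    3 * (w * suc w) ≤ k → j ≤ w →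
    2 ^ j * ((k + (k + g)) C k) ≤ 2 * ((k + (k + g + (j + j))) C k)
  window-after-increase k g w j 1≤k increase w-small j≤w = *-cancelˡ-≤ k {{>-nonZero 1≤k}} (begin
    k * (2 ^ j * C₀)          ≤⟨ *-monoˡ-≤ (2 ^ j * C₀) k≤2d ⟩
    (2 * d) * (2 ^ j * C₀)    ≡⟨ e₁ d (2 ^ j) C₀ ⟩
    2 * (d * 2 ^ j * C₀)      ≤⟨ *-monoʳ-≤ 2 (growth-after-increase k g 1≤k increase j d eq) ⟩
    2 * (k * Cⱼ)              ≡⟨ e₂ k Cⱼ ⟩
    k * (2 * Cⱼ)              ∎)
    where
      open ≤-Reasoning
      C₀ = (k + (k + g)) C k
      Cⱼ = (k + (k + g + (j + j))) C k
      m = j * (j ∸ 1)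
      2m≤3w[w+1] : ∀ j → j ≤ w → 2 * (j * (j ∸ 1)) ≤ 3 * (w * suc w)
      2m≤3w[w+1] zero _ = z≤n
      2m≤3w[w+1] (suc j) j<w = ≤-trans (≤-by-slack (j * suc j + 6 * suc j) (e j)) (*-monoʳ-≤ 3 (*-mono-≤ j<w (s≤s j<w)))
        where e : ∀ j → 2 * (suc j * j) + (j * suc j + 6 * suc j) ≡ 3 * (suc j * suc (suc j))
              e = solve-∀
      2m≤k : 2 * m ≤ k
      2m≤k = ≤-trans (2m≤3w[w+1] j j≤w) w-small
      d = k ∸ m
      eq : k ≡ d + m
      eq = sym (m∸n+n≡m (≤-trans (m≤m+n m (m + 0)) 2m≤k))
      k≤2d : k ≤ 2 * d
      k≤2d = +-cancelʳ-≤ (2 * m) k (2 * d) (≤-trans (+-monoʳ-≤ k 2m≤k) (≤-reflexive (trans (cong₂ _+_ eq eq) (e₃ d m))))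
        where e₃ : ∀ d m → (d + m) + (d + m) ≡ 2 * d + 2 * m
              e₃ = solve-∀
      e₁ : ∀ d p C → (2 * d) * (p * C) ≡ 2 * (d * p * C)
      e₁ = solve-∀
      e₂ : ∀ k X → 2 * (k * X) ≡ k * (2 * X)
      e₂ = solve-∀

  window-before-decrease : ∀ k g i → 1 ≤ k →
    2+ (k + (k + (g + (i + i)))) C k ≤ 2 * ((k + (k + (g + (i + i)))) C k) →
    3 * (i * suc i) ≤ k →
    (k + (k + (g + (i + i)))) C k ≤ 2 * 2 ^ i * ((k + (k + g)) C k)
  window-before-decrease k g i 1≤k decrease i-small = *-cancelˡ-≤ k {{>-nonZero 1≤k}} (begin
    k * Cᵢ                                ≤⟨ *-monoˡ-≤ Cᵢ k≤d ⟩
    d * Cᵢ                                ≤⟨ growth-before-decrease k (g + (i + i)) decrease i g refl d eq ⟩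
    2 * k * 2 ^ i * ((k + (k + g)) C k)   ≡⟨ e₁ k (2 ^ i) _ ⟩
    k * (2 * 2 ^ i * ((k + (k + g)) C k)) ∎)
    where
      open ≤-Reasoning
      Cᵢ = (k + (k + (g + (i + i)))) C k
      m = 3 * (i * suc i)
      d = 2 * k ∸ m
      eq : 2 * k ≡ d + m
      eq = sym (m∸n+n≡m (≤-trans i-small (m≤m+n k _)))
      k≤d : k ≤ d
      k≤d = +-cancelʳ-≤ m k d (≤-trans (+-monoʳ-≤ k i-small) (≤-reflexive (trans (cong (k +_) (sym (+-identityʳ k))) eq)))
      e₁ : ∀ k p C → 2 * k * p * C ≡ k * (2 * p * C)
      e₁ = solve-∀

module SilverRatio where

  open import Data.Nat
  open import Data.Nat.Properties
  open import Data.Nat.Tactic.RingSolver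
  open import Data.Product using (_×_; _,_; proj₁)
  open import Data.Sum using (inj₁; inj₂)
  open import Relation.Binary.PropositionalEquality
  open BinomialRatios using (≤-by-slack)

  -- (1 + √2)^m = silverRe m + silverIr m √2
  silverRe silverIr : ℕ → ℕ
  silverRe zero = 1
  silverRe (suc m) = silverRe m + 2 * silverIr m
  silverIr zero = 0
  silverIr (suc m) = silverRe m + silverIr m

  silver-+ : ∀ a b → silverRe (a + b) ≡ silverRe a * silverRe b + 2 * (silverIr a * silverIr b)
                   × silverIr (a + b) ≡ silverRe a * silverIr b + silverIr a * silverRe b
  silver-+ zero b = e₁ (silverRe b) (silverIr b) , e₂ (silverRe b) (silverIr b)
    where e₁ : ∀ x y → x ≡ 1 * x + 2 * (0 * y)
          e₁ = solve-∀
          e₂ : ∀ x y → y ≡ 1 * y + 0 * x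
          e₂ = solve-∀
  silver-+ (suc a) b with silver-+ a b
  ... | re , ir = trans (cong₂ (λ u v → u + 2 * v) re ir) (e₁ (silverRe a) (silverIr a) (silverRe b) (silverIr b)) ,
                  trans (cong₂ _+_ re ir) (e₂ (silverRe a) (silverIr a) (silverRe b) (silverIr b))
    where e₁ : ∀ p q x y → p * x + 2 * (q * y) + 2 * (p * y + q * x) ≡ (p + 2 * q) * x + 2 * ((p + q) * y)
          e₁ = solve-∀
          e₂ : ∀ p q x y → p * x + 2 * (q * y) + (p * y + q * x) ≡ (p + 2 * q) * y + (p + q) * x
          e₂ = solve-∀

  2mn≤m²+n² : ∀ m n → 2 * (m * n) ≤ m * m + n * n
  2mn≤m²+n² m n with ≤-total m n
  ... | inj₁ m≤n = subst (λ z → 2 * (m * z) ≤ m * m + z * z) (m+[n∸m]≡n m≤n) (≤-by-slack ((n ∸ m) * (n ∸ m)) (e m (n ∸ m)))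
    where e : ∀ a d → 2 * (a * (a + d)) + d * d ≡ a * a + (a + d) * (a + d)
          e = solve-∀
  ... | inj₂ n≤m = subst (λ z → 2 * (z * n) ≤ z * z + n * n) (m+[n∸m]≡n n≤m) (≤-by-slack ((m ∸ n) * (m ∸ n)) (e n (m ∸ n)))
    where e : ∀ b d → 2 * ((b + d) * b) + d * d ≡ (b + d) * (b + d) + b * b
          e = solve-∀

  silver-square-bound : ∀ k → let p = silverRe k ; q = silverIr k in
    (2 * (p + q)) * (2 * (p + q)) + 2 * ((p + 2 * q) * (p + 2 * q)) ≤ 14 * silverRe (k + k)
  silver-square-bound k = begin
    (2 * (p + q)) * (2 * (p + q)) + 2 * ((p + 2 * q) * (p + 2 * q)) ≡⟨ e₁ p q ⟩
    6 * (p * p) + 12 * (q * q) + 8 * (2 * (p * q))    ≤⟨ +-monoʳ-≤ (6 * (p * p) + 12 * (q * q)) (*-monoʳ-≤ 8 (2mn≤m²+n² p q)) ⟩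
    6 * (p * p) + 12 * (q * q) + 8 * (p * p + q * q)  ≤⟨ ≤-by-slack (8 * (q * q)) (e₂ p q) ⟩
    14 * (p * p + 2 * (q * q))                         ≡⟨ cong (14 *_) (silver-+ k k .proj₁) ⟨
    14 * silverRe (k + k)                              ∎
    where
      open ≤-Reasoning
      p = silverRe k
      q = silverIr k
      e₁ : ∀ p q → (2 * (p + q)) * (2 * (p + q)) + 2 * ((p + 2 * q) * (p + 2 * q)) ≡ 6 * (p * p) + 12 * (q * q) + 8 * (2 * (p * q))
      e₁ = solve-∀
      e₂ : ∀ p q → 6 * (p * p) + 12 * (q * q) + 8 * (p * p + q * q) + 8 * (q * q) ≡ 14 * (p * p + 2 * (q * q))
      e₂ = solve-∀

module DyadicSums where

  open import Data.Nat
  open import Data.Nat.Properties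
  open import Data.Nat.Combinatorics using (_C_)
  open import Data.Nat.Tactic.RingSolver
  open import Relation.Binary.PropositionalEquality
  open Binomial using (C-pascal)
  open SilverRatio

  double : ℕ → ℕ
  double zero = zero
  double (suc t) = 2+ (double t)

  dyadicSum : (ℕ → ℕ) → ℕ → ℕ
  dyadicSum a zero = a zero
  dyadicSum a (suc T) = 2 * dyadicSum a T + a (suc T)

  dyadicSum-+ : ∀ a b T → dyadicSum (λ t → a t + b t) T ≡ dyadicSum a T + dyadicSum b T
  dyadicSum-+ a b zero = refl
  dyadicSum-+ a b (suc T) =
    trans (cong (λ z → 2 * z + (a (suc T) + b (suc T))) (dyadicSum-+ a b T))
          (e (dyadicSum a T) (dyadicSum b T) (a (suc T)) (b (suc T)))
    where e : ∀ x y u v → 2 * (x + y) + (u + v) ≡ (2 * x + u) + (2 * y + v)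
          e = solve-∀

  dyadicSum-cong : ∀ {a b} → (∀ t → a t ≡ b t) → ∀ T → dyadicSum a T ≡ dyadicSum b T
  dyadicSum-cong a≗b zero = a≗b zero
  dyadicSum-cong a≗b (suc T) = cong₂ (λ x y → 2 * x + y) (dyadicSum-cong a≗b T) (a≗b (suc T))

  ≤-dyadicSum : ∀ a T → a T ≤ dyadicSum a T
  ≤-dyadicSum a zero = ≤-refl
  ≤-dyadicSum a (suc T) = m≤n+m (a (suc T)) (2 * dyadicSum a T)

  dyadicSum-window : ∀ a w T X c → w ≤ T →
    (∀ i b → b + i ≡ T → i ≤ w → X ≤ c * 2 ^ i * a b) →
    suc w * X ≤ c * dyadicSum a T
  dyadicSum-window a zero T X c _ bound = begin
    1 * X                ≡⟨ *-identityˡ X ⟩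
    X                    ≤⟨ bound 0 T (+-identityʳ T) z≤n ⟩
    c * 1 * a T          ≡⟨ cong (_* a T) (*-identityʳ c) ⟩
    c * a T              ≤⟨ *-monoʳ-≤ c (≤-dyadicSum a T) ⟩
    c * dyadicSum a T    ∎
    where open ≤-Reasoning
  dyadicSum-window a (suc w) (suc T) X c (s≤s w≤T) bound = begin
    2+ w * X                                    ≡⟨ e₁ w X ⟩
    suc w * X + X                               ≤⟨ +-mono-≤ IH last ⟩
    2 * c * dyadicSum a T + c * a (suc T)       ≡⟨ e₂ c (dyadicSum a T) (a (suc T)) ⟩
    c * (2 * dyadicSum a T + a (suc T))         ∎
    where
      open ≤-Reasoning
      e₁ : ∀ w X → 2+ w * X ≡ suc w * X + X
      e₁ = solve-∀
      e₂ : ∀ c s x → 2 * c * s + c * x ≡ c * (2 * s + x)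
      e₂ = solve-∀
      e₃ : ∀ c p x → c * (2 * p) * x ≡ 2 * c * p * x
      e₃ = solve-∀
      last : X ≤ c * a (suc T)
      last = ≤-trans (bound 0 (suc T) (+-identityʳ _) z≤n) (≤-reflexive (cong (_* a (suc T)) (*-identityʳ c)))
      IH : suc w * X ≤ 2 * c * dyadicSum a T
      IH = dyadicSum-window a w T X (2 * c) w≤T λ i b b+i≡T i≤w →
        ≤-trans (bound (suc i) b (trans (+-suc b i) (cong suc b+i≡T)) (s≤s i≤w)) (≤-reflexive (e₃ c (2 ^ i) (a b)))

  evenBinomials oddBinomials : ℕ → ℕ → ℕ
  evenBinomials k = dyadicSum (λ t → double t C k)
  oddBinomials k = dyadicSum (λ t → suc (double t) C k)

  oddBinomials-suc : ∀ k T → oddBinomials (suc k) T ≡ evenBinomials k T + evenBinomials (suc k) T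
  oddBinomials-suc k T =
    trans (dyadicSum-cong (λ t → C-pascal (double t) k) T)
          (dyadicSum-+ (λ t → double t C k) (λ t → double t C suc k) T)

  evenBinomials-suc : ∀ k T → evenBinomials (suc k) (suc T) ≡ oddBinomials k T + oddBinomials (suc k) T
  evenBinomials-suc k zero = C-pascal 1 k
  evenBinomials-suc k (suc T) =
    trans (cong₂ (λ x y → 2 * x + y) (evenBinomials-suc k T) (C-pascal (suc (double (suc T))) k))
          (e (oddBinomials k T) (oddBinomials (suc k) T) (suc (double (suc T)) C k) (suc (double (suc T)) C suc k))
    where e : ∀ x y u v → 2 * (x + y) + (u + v) ≡ (2 * x + u) + (2 * y + v)
          e = solve-∀

  evenBinomials-zero : ∀ T → evenBinomials 0 T + 1 ≡ 2 * 2 ^ T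
  evenBinomials-zero zero = refl
  evenBinomials-zero (suc T) = trans (e (evenBinomials 0 T)) (cong (2 *_) (evenBinomials-zero T))
    where e : ∀ x → 2 * x + 1 + 1 ≡ 2 * (x + 1)
          e = solve-∀

  mutual
    evenBinomials-bound : ∀ k T → evenBinomials k T ≤ 2 * (silverRe k + silverIr k) * 2 ^ T
    evenBinomials-bound zero T = ≤-trans (m≤m+n (evenBinomials 0 T) 1) (≤-reflexive (evenBinomials-zero T))
    evenBinomials-bound (suc k) zero = z≤n
    evenBinomials-bound (suc k) (suc T) = begin
      evenBinomials (suc k) (suc T)                       ≡⟨ evenBinomials-suc k T ⟩
      oddBinomials k T + oddBinomials (suc k) T           ≤⟨ +-mono-≤ (oddBinomials-bound k T) (oddBinomials-bound (suc k) T) ⟩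
      2 * (p + 2 * q) * 2 ^ T + 2 * ((p + 2 * q) + 2 * (p + q)) * 2 ^ T ≡⟨ e p q (2 ^ T) ⟩
      2 * ((p + 2 * q) + (p + q)) * 2 ^ suc T             ∎
      where
        open ≤-Reasoning
        p = silverRe k
        q = silverIr k
        e : ∀ p q t → 2 * (p + 2 * q) * t + 2 * ((p + 2 * q) + 2 * (p + q)) * t ≡ 2 * ((p + 2 * q) + (p + q)) * (2 * t)
        e = solve-∀

    oddBinomials-bound : ∀ k T → oddBinomials k T ≤ 2 * (silverRe k + 2 * silverIr k) * 2 ^ T
    oddBinomials-bound zero T = evenBinomials-bound zero T
    oddBinomials-bound (suc k) T = begin
      oddBinomials (suc k) T                              ≡⟨ oddBinomials-suc k T ⟩
      evenBinomials k T + evenBinomials (suc k) T         ≤⟨ +-mono-≤ (evenBinomials-bound k T) (evenBinomials-bound (suc k) T) ⟩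
      2 * (p + q) * 2 ^ T + 2 * ((p + 2 * q) + (p + q)) * 2 ^ T ≡⟨ e p q (2 ^ T) ⟩
      2 * ((p + 2 * q) + 2 * (p + q)) * 2 ^ T             ∎
      where
        open ≤-Reasoning
        p = silverRe k
        q = silverIr k
        e : ∀ p q t → 2 * (p + q) * t + 2 * ((p + 2 * q) + (p + q)) * t ≡ 2 * ((p + 2 * q) + 2 * (p + q)) * t
        e = solve-∀

module BinomialWindow where

  open import Data.Nat
  open import Data.Nat.Properties
  open import Data.Nat.Combinatorics using (_C_)
  open import Data.Nat.Tactic.RingSolver
  open import Relation.Nullary using (yes; no)
  open import Relation.Binary.PropositionalEquality
  open BinomialRatios
  open DyadicSums

  double-+ : ∀ s j → double (s + j) ≡ double s + (j + j)
  double-+ zero zero = refl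
  double-+ zero (suc j) = trans (cong 2+ (double-+ zero j)) (cong suc (sym (+-suc j j)))
  double-+ (suc s) j = cong 2+ (double-+ s j)

  double-mono : ∀ {a b} → a ≤ b → double a ≤ double b
  double-mono z≤n = z≤n
  double-mono (s≤s a≤b) = s≤s (s≤s (double-mono a≤b))

  double≡+ : ∀ a → double a ≡ a + a
  double≡+ = double-+ zero

  halve-≤ : ∀ x s π → π ≤ 1 → double x ≤ π + double s → x ≤ s
  halve-≤ zero s π _ _ = z≤n
  halve-≤ (suc x) zero zero _ ()
  halve-≤ (suc x) zero (suc zero) _ (s≤s ())
  halve-≤ (suc x) zero (2+ π) (s≤s ()) _
  halve-≤ (suc x) (suc s) π π≤1 h = s≤s (halve-≤ x s π π≤1 (s≤s⁻¹ (s≤s⁻¹ (subst (double (suc x) ≤_) (e π (double s)) h))))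
    where e : ∀ π y → π + 2+ y ≡ 2+ (π + y)
          e π y = trans (+-suc π (suc y)) (cong suc (+-suc π y))

  split-2k : ∀ k r → k + k ≤ r → r ≡ k + (k + (r ∸ (k + k)))
  split-2k k r h = trans (sym (m+[n∸m]≡n h)) (+-assoc k k _)

  module _ (π k s w B : ℕ) (π≤1 : π ≤ 1) (1≤k : 1 ≤ k) (w-small : 3 * (w * suc w) ≤ k)
           (r-large : k + k + (w + w) ≤ π + double s)
           (sum-bound : ∀ T → dyadicSum (λ t → (π + double t) C k) T ≤ B * 2 ^ T) where

    private
      r = π + double s
      a = λ t → (π + double t) C k

    -- If C(r, k) is still growing by a factor ≥ 2, it is dominated by the next w + 1 terms of the sum.
    window-bound-increasing : 2 * (r C k) ≤ 2+ r C k → suc w * (r C k) ≤ 2 * B * 2 ^ s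
    window-bound-increasing increase = *-cancelˡ-≤ (2 ^ w) {{m^n≢0 2 w}} (begin
      2 ^ w * (suc w * (r C k))         ≡⟨ e₁ (2 ^ w) (suc w) (r C k) ⟩
      suc w * (2 ^ w * (r C k))         ≤⟨ dyadicSum-window a w (s + w) (2 ^ w * (r C k)) 2 (m≤n+m w s) dominated ⟩
      2 * dyadicSum a (s + w)           ≤⟨ *-monoʳ-≤ 2 (sum-bound (s + w)) ⟩
      2 * (B * 2 ^ (s + w))             ≡⟨ cong (λ z → 2 * (B * z)) (^-distribˡ-+-* 2 s w) ⟩
      2 * (B * (2 ^ s * 2 ^ w))         ≡⟨ e₂ (2 ^ w) B (2 ^ s) ⟩
      2 ^ w * (2 * B * 2 ^ s)           ∎)
      where
        open ≤-Reasoning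
        g = r ∸ (k + k)
        r≡ : r ≡ k + (k + g)
        r≡ = split-2k k r (≤-trans (m≤m+n (k + k) (w + w)) r-large)
        e₁ : ∀ p w C → p * (w * C) ≡ w * (p * C)
        e₁ = solve-∀
        e₂ : ∀ p B q → 2 * (B * (q * p)) ≡ p * (2 * B * q)
        e₂ = solve-∀
        dominated : ∀ i b → b + i ≡ s + w → i ≤ w → 2 ^ w * (r C k) ≤ 2 * 2 ^ i * a b
        dominated i b b+i≡s+w i≤w = begin
          2 ^ w * (r C k)                       ≡⟨ cong (λ z → 2 ^ z * (r C k)) w≡i+j ⟩
          2 ^ (i + j) * (r C k)                 ≡⟨ cong (_* (r C k)) (^-distribˡ-+-* 2 i j) ⟩
          2 ^ i * 2 ^ j * (r C k)               ≡⟨ *-assoc (2 ^ i) (2 ^ j) (r C k) ⟩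
          2 ^ i * (2 ^ j * (r C k))             ≤⟨ *-monoʳ-≤ (2 ^ i) growth ⟩
          2 ^ i * (2 * ((k + (k + g + (j + j))) C k)) ≡⟨ cong (λ z → 2 ^ i * (2 * (z C k))) index ⟩
          2 ^ i * (2 * a b)                     ≡⟨ e₃ (2 ^ i) (a b) ⟩
          2 * 2 ^ i * a b                       ∎
          where
            j = w ∸ i
            w≡i+j : w ≡ i + j
            w≡i+j = sym (m+[n∸m]≡n i≤w)
            b≡s+j : b ≡ s + j
            b≡s+j = +-cancelʳ-≡ i b (s + j) (trans b+i≡s+w (trans (cong (s +_) w≡i+j) (e₄ s i j)))
              where e₄ : ∀ s i j → s + (i + j) ≡ s + j + i
                    e₄ = solve-∀
            growth : 2 ^ j * (r C k) ≤ 2 * ((k + (k + g + (j + j))) C k)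
            growth = subst (λ z → 2 ^ j * (z C k) ≤ 2 * ((k + (k + g + (j + j))) C k)) (sym r≡)
              (window-after-increase k g w j 1≤k (subst (λ z → 2 * (z C k) ≤ 2+ z C k) r≡ increase) w-small (m∸n≤m w i))
            index : k + (k + g + (j + j)) ≡ π + double b
            index = trans (e₅ k g (j + j)) (trans (cong (_+ (j + j)) (sym r≡)) (trans (+-assoc π (double s) (j + j))
                      (cong (π +_) (trans (sym (double-+ s j)) (cong double (sym b≡s+j))))))
              where e₅ : ∀ k g t → k + (k + g + t) ≡ k + (k + g) + t
                    e₅ = solve-∀
            e₃ : ∀ p x → p * (2 * x) ≡ 2 * p * x
            e₃ = solve-∀

    -- If C(r, k) is already shrinking, it is dominated by the previous w + 1 terms of the sum.
    window-bound-decreasing : 2+ r C k ≤ 2 * (r C k) → suc w * (r C k) ≤ 2 * B * 2 ^ s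
    window-bound-decreasing decrease = begin
      suc w * (r C k)       ≤⟨ dyadicSum-window a w s (r C k) 2 w≤s dominated ⟩
      2 * dyadicSum a s     ≤⟨ *-monoʳ-≤ 2 (sum-bound s) ⟩
      2 * (B * 2 ^ s)       ≡⟨ *-assoc 2 B (2 ^ s) ⟨
      2 * B * 2 ^ s         ∎
      where
        open ≤-Reasoning
        k+w≤s : k + w ≤ s
        k+w≤s = halve-≤ (k + w) s π π≤1 (subst (_≤ π + double s) (trans (e k w) (sym (double≡+ (k + w)))) r-large)
          where e : ∀ k w → k + k + (w + w) ≡ (k + w) + (k + w)
                e = solve-∀
        w≤s : w ≤ s
        w≤s = ≤-trans (m≤n+m w k) k+w≤s
        dominated : ∀ i b → b + i ≡ s → i ≤ w → r C k ≤ 2 * 2 ^ i * a b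
        dominated i b b+i≡s i≤w = begin
          r C k                                  ≡⟨ cong (_C k) r≡ ⟩
          (k + (k + (g + (i + i)))) C k          ≤⟨ window-before-decrease k g i 1≤k decrease′ (≤-trans (*-monoʳ-≤ 3 (*-mono-≤ i≤w (s≤s i≤w))) w-small) ⟩
          2 * 2 ^ i * ((k + (k + g)) C k)        ≡⟨ cong (λ z → 2 * 2 ^ i * (z C k)) (sym b-split) ⟩
          2 * 2 ^ i * a b                        ∎
          where
            rb = π + double b
            kk≤rb : k + k ≤ rb
            kk≤rb = ≤-trans (≤-reflexive (sym (double≡+ k)))
              (≤-trans (double-mono (+-cancelʳ-≤ i k b (≤-trans (+-monoʳ-≤ k i≤w) (≤-trans k+w≤s (≤-reflexive (sym b+i≡s))))))
                       (m≤n+m (double b) π))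
            g = rb ∸ (k + k)
            b-split : rb ≡ k + (k + g)
            b-split = split-2k k rb kk≤rb
            r≡ : r ≡ k + (k + (g + (i + i)))
            r≡ = begin-equality
              π + double s                ≡⟨ cong (λ z → π + double z) (sym b+i≡s) ⟩
              π + double (b + i)          ≡⟨ cong (π +_) (double-+ b i) ⟩
              π + (double b + (i + i))    ≡⟨ +-assoc π (double b) (i + i) ⟨
              rb + (i + i)                ≡⟨ cong (_+ (i + i)) b-split ⟩
              k + (k + g) + (i + i)       ≡⟨ e k g (i + i) ⟩
              k + (k + (g + (i + i)))     ∎
              where e : ∀ k g t → k + (k + g) + t ≡ k + (k + (g + t))
                    e = solve-∀
            decrease′ : 2+ (k + (k + (g + (i + i)))) C k ≤ 2 * ((k + (k + (g + (i + i)))) C k)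
            decrease′ = subst (λ z → 2+ z C k ≤ 2 * (z C k)) r≡ decrease

  window-bound : ∀ π k s w B → π ≤ 1 → 1 ≤ k → 3 * (w * suc w) ≤ k → k + k + (w + w) ≤ π + double s →
    (∀ T → dyadicSum (λ t → (π + double t) C k) T ≤ B * 2 ^ T) →
    suc w * ((π + double s) C k) ≤ 2 * B * 2 ^ s
  window-bound π k s w B π≤1 1≤k w-small r-large sum-bound
    with 2 * ((π + double s) C k) ≤? 2+ (π + double s) C k
  ... | yes increase = window-bound-increasing π k s w B π≤1 1≤k w-small r-large sum-bound increase
  ... | no ¬increase = window-bound-decreasing π k s w B π≤1 1≤k w-small r-large sum-bound (<⇒≤ (≰⇒> ¬increase))

module BinomialSquareBound where

  open import Data.Nat
  open import Data.Nat.Properties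
  open import Data.Nat.Combinatorics using (_C_)
  open import Data.Nat.Tactic.RingSolver
  open import Data.Product using (Σ; _×_; _,_)
  open import Data.Sum using (_⊎_; inj₁; inj₂)
  open import Relation.Nullary using (yes; no)
  open import Relation.Binary.PropositionalEquality
  open BinomialRatios using (≤-by-slack)
  open SilverRatio
  open DyadicSums
  open BinomialWindow

  largest-width : ∀ k → Σ ℕ λ w → 3 * (w * suc w) ≤ k × k < 3 * (suc w * 2+ w)
  largest-width zero = 0 , z≤n , s≤s z≤n
  largest-width (suc k) with largest-width k
  ... | w , lower , upper with suc k <? 3 * (suc w * 2+ w)
  ... | yes k<bound = w , ≤-trans lower (n≤1+n k) , k<bound
  ... | no ¬k<bound = suc w , ≤-reflexive (sym k≡) , subst (_< 3 * (2+ w * suc (2+ w))) (sym k≡) (≤-by-slack (6 * w + 11) (e w))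
    where k≡ : suc k ≡ 3 * (suc w * 2+ w)
          k≡ = ≤-antisym upper (≮⇒≥ ¬k<bound)
          e : ∀ w → suc (3 * (suc w * suc (suc w))) + (6 * w + 11) ≡ 3 * (suc (suc w) * suc (suc (suc w)))
          e = solve-∀

  window-width : ∀ k → Σ ℕ λ w → 3 * (w * suc w) ≤ k × k ≤ 6 * (suc w * suc w)
  window-width k with largest-width k
  ... | w , lower , upper = w , lower , ≤-trans (<⇒≤ upper) (≤-by-slack (3 * (w * suc w)) (e w))
    where e : ∀ w → 3 * (suc w * suc (suc w)) + 3 * (w * suc w) ≡ 6 * (suc w * suc w)
          e = solve-∀

  6w≤3w[w+1] : ∀ w → 6 * w ≤ 3 * (w * suc w)
  6w≤3w[w+1] zero = z≤n
  6w≤3w[w+1] (suc v) = ≤-by-slack (3 * (v * suc v)) (e v)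
    where e : ∀ v → 6 * suc v + 3 * (v * suc v) ≡ 3 * (suc v * suc (suc v))
          e = solve-∀

  halves : ∀ r → Σ ℕ λ s → r ≡ double s ⊎ r ≡ suc (double s)
  halves zero = 0 , inj₁ refl
  halves (suc zero) = 0 , inj₂ refl
  halves (2+ r) with halves r
  ... | s , inj₁ r≡ = suc s , inj₁ (cong 2+ r≡)
  ... | s , inj₂ r≡ = suc s , inj₂ (cong 2+ r≡)

  squared-window-bound : ∀ r k w → 1 ≤ k → 3 * (w * suc w) ≤ k → k + k + (w + w) ≤ r →
    let α = 2 * (silverRe k + silverIr k) ; β = silverRe k + 2 * silverIr k ; X = suc w * (r C k) in
    X * X ≤ 4 * (α * α + 2 * (β * β)) * 2 ^ r
  squared-window-bound r k w 1≤k w-small r-large with halves r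
  ... | s , inj₁ r≡ = begin
    X * X                                   ≤⟨ *-mono-≤ X≤ X≤ ⟩
    (2 * α * 2 ^ s) * (2 * α * 2 ^ s)       ≡⟨ e₁ α (2 ^ s) ⟩
    4 * (α * α) * (2 ^ s * 2 ^ s)           ≤⟨ *-monoˡ-≤ (2 ^ s * 2 ^ s) (*-monoʳ-≤ 4 (m≤m+n (α * α) _)) ⟩
    4 * (α * α + 2 * (β * β)) * (2 ^ s * 2 ^ s) ≡⟨ cong (4 * (α * α + 2 * (β * β)) *_) 2^r≡ ⟨
    4 * (α * α + 2 * (β * β)) * 2 ^ r       ∎
    where
      open ≤-Reasoning
      α = 2 * (silverRe k + silverIr k)
      β = silverRe k + 2 * silverIr k
      X = suc w * (r C k)
      X≤ : X ≤ 2 * α * 2 ^ s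
      X≤ = subst (λ z → suc w * (z C k) ≤ 2 * α * 2 ^ s) (sym r≡)
             (window-bound 0 k s w α z≤n 1≤k w-small (subst (k + k + (w + w) ≤_) r≡ r-large) (evenBinomials-bound k))
      2^r≡ : 2 ^ r ≡ 2 ^ s * 2 ^ s
      2^r≡ = trans (cong (2 ^_) (trans r≡ (double≡+ s))) (^-distribˡ-+-* 2 s s)
      e₁ : ∀ a p → (2 * a * p) * (2 * a * p) ≡ 4 * (a * a) * (p * p)
      e₁ = solve-∀
  ... | s , inj₂ r≡ = begin
    X * X                                   ≤⟨ *-mono-≤ X≤ X≤ ⟩
    (2 * (2 * β) * 2 ^ s) * (2 * (2 * β) * 2 ^ s) ≡⟨ e₁ β (2 ^ s) ⟩
    4 * (2 * (β * β)) * (2 * (2 ^ s * 2 ^ s)) ≤⟨ *-monoˡ-≤ (2 * (2 ^ s * 2 ^ s)) (*-monoʳ-≤ 4 (m≤n+m (2 * (β * β)) (α * α))) ⟩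
    4 * (α * α + 2 * (β * β)) * (2 * (2 ^ s * 2 ^ s)) ≡⟨ cong (4 * (α * α + 2 * (β * β)) *_) 2^r≡ ⟨
    4 * (α * α + 2 * (β * β)) * 2 ^ r       ∎
    where
      open ≤-Reasoning
      α = 2 * (silverRe k + silverIr k)
      β = silverRe k + 2 * silverIr k
      X = suc w * (r C k)
      X≤ : X ≤ 2 * (2 * β) * 2 ^ s
      X≤ = subst (λ z → suc w * (z C k) ≤ 2 * (2 * β) * 2 ^ s) (sym r≡)
             (window-bound 1 k s w (2 * β) ≤-refl 1≤k w-small (subst (k + k + (w + w) ≤_) r≡ r-large) (oddBinomials-bound k))
      2^r≡ : 2 ^ r ≡ 2 * (2 ^ s * 2 ^ s)
      2^r≡ = trans (cong (2 ^_) (trans r≡ (cong suc (double≡+ s)))) (cong (2 *_) (^-distribˡ-+-* 2 s s))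
      e₁ : ∀ b p → (2 * (2 * b) * p) * (2 * (2 * b) * p) ≡ 4 * (2 * (b * b)) * (2 * (p * p))
      e₁ = solve-∀

  binomial-square-bound : ∀ r k → 1 ≤ k → 7 * k ≤ 3 * r → k * ((r C k) * (r C k)) ≤ 336 * silverRe (k + k) * 2 ^ r
  binomial-square-bound r k 1≤k 7k≤3r with window-width k
  ... | w , w-small , k-bound = begin
    k * (c * c)                                    ≤⟨ *-monoˡ-≤ (c * c) k-bound ⟩
    6 * (suc w * suc w) * (c * c)                  ≡⟨ e₁ (suc w) c ⟩
    6 * ((suc w * c) * (suc w * c))                ≤⟨ *-monoʳ-≤ 6 (squared-window-bound r k w 1≤k w-small r-large) ⟩
    6 * (4 * (α * α + 2 * (β * β)) * 2 ^ r)        ≡⟨ e₂ (α * α + 2 * (β * β)) (2 ^ r) ⟩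
    24 * (α * α + 2 * (β * β)) * 2 ^ r             ≤⟨ *-monoˡ-≤ (2 ^ r) (*-monoʳ-≤ 24 (silver-square-bound k)) ⟩
    24 * (14 * silverRe (k + k)) * 2 ^ r           ≡⟨ cong (_* 2 ^ r) (*-assoc 24 14 (silverRe (k + k))) ⟨
    336 * silverRe (k + k) * 2 ^ r                 ∎
    where
      open ≤-Reasoning
      c = r C k
      α = 2 * (silverRe k + silverIr k)
      β = silverRe k + 2 * silverIr k
      r-large : k + k + (w + w) ≤ r
      r-large = *-cancelˡ-≤ 3 (begin
        3 * (k + k + (w + w))     ≡⟨ e₃ k w ⟩
        6 * k + 6 * w             ≤⟨ +-monoʳ-≤ (6 * k) (≤-trans (6w≤3w[w+1] w) w-small) ⟩
        6 * k + k                 ≡⟨ e₄ k ⟩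
        7 * k                     ≤⟨ 7k≤3r ⟩
        3 * r                     ∎)
        where e₃ : ∀ k w → 3 * (k + k + (w + w)) ≡ 6 * k + 6 * w
              e₃ = solve-∀
              e₄ : ∀ k → 6 * k + k ≡ 7 * k
              e₄ = solve-∀
      e₁ : ∀ u c → 6 * (u * u) * (c * c) ≡ 6 * ((u * c) * (u * c))
      e₁ = solve-∀
      e₂ : ∀ x p → 6 * (4 * x * p) ≡ 24 * x * p
      e₂ = solve-∀

module HammingBall where

  open import Data.Nat
  open import Data.Nat.Properties
  open import Data.Nat.Combinatorics using (_C_)
  open import Data.Nat.Tactic.RingSolver
  open import Relation.Binary.PropositionalEquality
  open Binomial

  hammingBall : ℕ → ℕ → ℕ
  hammingBall r zero = 1
  hammingBall r (suc k) = r C suc k + hammingBall r k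

  hammingBall-pos : ∀ r k → 1 ≤ hammingBall r k
  hammingBall-pos r zero = ≤-refl
  hammingBall-pos r (suc k) = ≤-trans (hammingBall-pos r k) (m≤n+m _ _)

  hammingBall-suc : ∀ r k → hammingBall (suc r) (suc k) ≡ hammingBall r (suc k) + hammingBall r k
  hammingBall-suc r zero = trans (cong (_+ 1) (C-pascal r 0)) (e (r C 1))
    where e : ∀ x → (1 + x) + 1 ≡ (x + 1) + 1
          e = solve-∀
  hammingBall-suc r (suc k) =
    trans (cong₂ _+_ (C-pascal r (suc k)) (hammingBall-suc r k))
          (e (r C suc k) (r C 2+ k) (hammingBall r (suc k)) (hammingBall r k))
    where e : ∀ a b c d → (a + b) + (c + d) ≡ (b + c) + (a + d)
          e = solve-∀

  hammingBall≤2^r : ∀ r k → hammingBall r k ≤ 2 ^ r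
  hammingBall≤2^r r zero = m^n>0 2 r
  hammingBall≤2^r zero (suc k) = hammingBall≤2^r zero k
  hammingBall≤2^r (suc r) (suc k) = begin
    hammingBall (suc r) (suc k)            ≡⟨ hammingBall-suc r k ⟩
    hammingBall r (suc k) + hammingBall r k ≤⟨ +-mono-≤ (hammingBall≤2^r r (suc k)) (hammingBall≤2^r r k) ⟩
    2 ^ r + 2 ^ r                          ≡⟨ cong (2 ^ r +_) (+-identityʳ (2 ^ r)) ⟨
    2 ^ suc r                              ∎
    where open ≤-Reasoning

  4C≤3C[1+k] : ∀ r k → 7 * suc k ≤ 3 * r → 4 * (r C k) ≤ 3 * (r C suc k)
  4C≤3C[1+k] r k 7k≤3r = subst (λ z → 4 * (z C k) ≤ 3 * (z C suc k)) (sym r≡) (*-cancelˡ-≤ (suc d) (begin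
    suc d * (4 * (suc (k + d) C k))       ≡⟨ e₁ (suc d) (suc (k + d) C k) ⟩
    4 * ((suc (k + d) C k) * suc d)       ≡⟨ cong (4 *_) (trans (absorption (k + d) k) (sym (C-step k d))) ⟨
    4 * (suc k * (suc (k + d) C suc k))   ≡⟨ *-assoc 4 (suc k) _ ⟨
    4 * suc k * (suc (k + d) C suc k)     ≤⟨ *-monoˡ-≤ _ 4[k+1]≤3[d+1] ⟩
    3 * suc d * (suc (k + d) C suc k)     ≡⟨ e₂ (suc d) (suc (k + d) C suc k) ⟩
    suc d * (3 * (suc (k + d) C suc k))   ∎))
    where
      open ≤-Reasoning
      k<r : suc k ≤ r
      k<r = *-cancelˡ-≤ 7 (≤-trans 7k≤3r (*-monoˡ-≤ r (≤ᵇ⇒≤ 3 7 _)))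
      d = r ∸ suc k
      r≡ : r ≡ suc (k + d)
      r≡ = sym (m+[n∸m]≡n k<r)
      e₁ : ∀ a c → a * (4 * c) ≡ 4 * (c * a)
      e₁ = solve-∀
      e₂ : ∀ a c → 3 * a * c ≡ a * (3 * c)
      e₂ = solve-∀
      e₃ : ∀ k → 3 * suc k + 4 * suc k ≡ 7 * suc k
      e₃ = solve-∀
      e₄ : ∀ k d → 3 * suc (k + d) ≡ 3 * suc k + 3 * d
      e₄ = solve-∀
      4[k+1]≤3[d+1] : 4 * suc k ≤ 3 * suc d
      4[k+1]≤3[d+1] = +-cancelˡ-≤ (3 * suc k) _ _ (begin
        3 * suc k + 4 * suc k    ≡⟨ e₃ k ⟩
        7 * suc k                ≤⟨ 7k≤3r ⟩
        3 * r                    ≡⟨ trans (cong (3 *_) r≡) (e₄ k d) ⟩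
        3 * suc k + 3 * d        ≤⟨ +-monoʳ-≤ (3 * suc k) (*-monoʳ-≤ 3 (n≤1+n d)) ⟩
        3 * suc k + 3 * suc d    ∎)

  -- Below k = 3r/7 the partial sum of binomial coefficients is a geometric series of ratio ≤ 3/4.
  hammingBall≤4C : ∀ r k → 7 * k ≤ 3 * r → hammingBall r k ≤ 4 * (r C k)
  hammingBall≤4C r zero _ = s≤s z≤n
  hammingBall≤4C r (suc k) 7k≤3r = begin
    r C suc k + hammingBall r k    ≤⟨ +-monoʳ-≤ (r C suc k) (hammingBall≤4C r k (≤-trans (*-monoʳ-≤ 7 (n≤1+n k)) 7k≤3r)) ⟩
    r C suc k + 4 * (r C k)        ≤⟨ +-monoʳ-≤ (r C suc k) (4C≤3C[1+k] r k 7k≤3r) ⟩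
    r C suc k + 3 * (r C suc k)    ≡⟨ e (r C suc k) ⟩
    4 * (r C suc k)                ∎
    where
      open ≤-Reasoning
      e : ∀ x → x + 3 * x ≡ 4 * x
      e = solve-∀

module CrudeBound where

  open import Data.Nat
  open import Data.Nat.Properties
  open import Data.Nat.Tactic.RingSolver
  open import Data.Empty using (⊥-elim)
  open import Relation.Nullary using (yes; no)
  open import Relation.Binary.PropositionalEquality
  open BinomialRatios using (≤-by-slack)
  open SilverRatio
  open DyadicSums using (double)

  silverRe-2+ : ∀ n → silverRe (2+ n) ≡ 3 * silverRe n + 4 * silverIr n
  silverRe-2+ n = e (silverRe n) (silverIr n)
    where e : ∀ p q → (p + 2 * q) + 2 * (p + q) ≡ 3 * p + 4 * q
          e = solve-∀

  silverIr-2+ : ∀ n → silverIr (2+ n) ≡ 2 * silverRe n + 3 * silverIr n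
  silverIr-2+ n = e (silverRe n) (silverIr n)
    where e : ∀ p q → (p + 2 * q) + (p + q) ≡ 2 * p + 3 * q
          e = solve-∀

  2Re≤3Ir : ∀ m → 2 * silverRe (double (suc m)) ≤ 3 * silverIr (double (suc m))
  2Re≤3Ir zero = ≤-refl
  2Re≤3Ir (suc m) = subst₂ (λ a b → 2 * a ≤ 3 * b) (sym (silverRe-2+ n)) (sym (silverIr-2+ n))
     (≤-by-slack (silverIr n) (e (silverRe n) (silverIr n)))
    where n = double (suc m)
          e : ∀ p q → 2 * (3 * p + 4 * q) + q ≡ 3 * (2 * p + 3 * q)
          e = solve-∀

  -- (1 + √2)^2 = 3 + 2√2 > 17 / 3
  silverRe-lower : ∀ m → 3 * 17 ^ m ≤ 3 ^ m * silverRe (double (suc m))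
  silverRe-lower zero = ≤-refl
  silverRe-lower (suc m) = begin
    3 * (17 * 17 ^ m)                 ≡⟨ e₁ (17 ^ m) ⟩
    17 * (3 * 17 ^ m)                 ≤⟨ *-monoʳ-≤ 17 (silverRe-lower m) ⟩
    17 * (3 ^ m * P)                  ≡⟨ e₂ (3 ^ m) P ⟩
    3 ^ m * (9 * P + 4 * (2 * P))     ≤⟨ *-monoʳ-≤ (3 ^ m) (+-monoʳ-≤ (9 * P) (*-monoʳ-≤ 4 (2Re≤3Ir m))) ⟩
    3 ^ m * (9 * P + 4 * (3 * Q))     ≡⟨ e₃ (3 ^ m) P Q ⟩
    3 * 3 ^ m * (3 * P + 4 * Q)       ≡⟨ cong (3 * 3 ^ m *_) (silverRe-2+ (double (suc m))) ⟨
    3 * 3 ^ m * silverRe (double (2+ m)) ∎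
    where
      open ≤-Reasoning
      P = silverRe (double (suc m))
      Q = silverIr (double (suc m))
      e₁ : ∀ x → 3 * (17 * x) ≡ 17 * (3 * x)
      e₁ = solve-∀
      e₂ : ∀ t p → 17 * (t * p) ≡ t * (9 * p + 4 * (2 * p))
      e₂ = solve-∀
      e₃ : ∀ t p q → t * (9 * p + 4 * (3 * q)) ≡ 3 * t * (3 * p + 4 * q)
      e₃ = solve-∀

  cube-ratio : ∀ d → (d + 10) * (d + 10) * (d + 10) * 3456 ≤ (d + 9) * (d + 9) * (d + 9) * 4913
  cube-ratio d = ≤-by-slack (1457 * (d * d * d) + 28971 * (d * d) + 157059 * d + 125577) (expand d)
    where expand : ∀ d → (d + 10) * (d + 10) * (d + 10) * 3456 + (1457 * (d * d * d) + 28971 * (d * d) + 157059 * d + 125577)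
                       ≡ (d + 9) * (d + 9) * (d + 9) * 4913
          expand = solve-∀

  cube-vs-exponential-from-8 : ∀ d → 128 * ((d + 9) * (d + 9) * (d + 9)) * (3456 ^ 8 * 3456 ^ d) ≤ 54000 * (4913 ^ 8 * 4913 ^ d)
  cube-vs-exponential-from-8 zero = ≤ᵇ⇒≤ _ _ _
  cube-vs-exponential-from-8 (suc d) = begin
    128 * ((suc d + 9) * (suc d + 9) * (suc d + 9)) * (3456 ^ 8 * 3456 ^ suc d)
      ≡⟨ e₁ 128 3456 (suc d + 9) (3456 ^ 8) (3456 ^ d) ⟩
    128 * ((suc d + 9) * (suc d + 9) * (suc d + 9) * 3456) * (3456 ^ 8 * 3456 ^ d)
      ≤⟨ *-monoˡ-≤ (3456 ^ 8 * 3456 ^ d) (*-monoʳ-≤ 128 (subst (λ z → z * z * z * 3456 ≤ (d + 9) * (d + 9) * (d + 9) * 4913) (e₂ d) (cube-ratio d))) ⟩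
    128 * ((d + 9) * (d + 9) * (d + 9) * 4913) * (3456 ^ 8 * 3456 ^ d)
      ≡⟨ e₃ 128 4913 (d + 9) (3456 ^ 8 * 3456 ^ d) ⟩
    4913 * (128 * ((d + 9) * (d + 9) * (d + 9)) * (3456 ^ 8 * 3456 ^ d))
      ≤⟨ *-monoʳ-≤ 4913 (cube-vs-exponential-from-8 d) ⟩
    4913 * (54000 * (4913 ^ 8 * 4913 ^ d))
      ≡⟨ e₄ 4913 54000 (4913 ^ 8) (4913 ^ d) ⟩
    54000 * (4913 ^ 8 * 4913 ^ suc d)
      ∎
    where
      open ≤-Reasoning
      e₁ : ∀ u v c a x → u * (c * c * c) * (a * (v * x)) ≡ u * (c * c * c * v) * (a * x)
      e₁ = solve-∀
      e₂ : ∀ d → d + 10 ≡ suc d + 9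
      e₂ = solve-∀
      e₃ : ∀ u v c x → u * (c * c * c * v) * x ≡ v * (u * (c * c * c) * x)
      e₃ = solve-∀
      e₄ : ∀ u v b x → u * (v * (b * x)) ≡ v * (b * (u * x))
      e₄ = solve-∀

  -- 27 · 128 = 3456 < 4913 = 17^3, so the exponential eventually beats the cube; the first 8 cases are numerical.
  cube-vs-exponential : ∀ m → 128 * (suc m * suc m * suc m) * 3456 ^ m ≤ 54000 * 4913 ^ m
  cube-vs-exponential 0 = ≤ᵇ⇒≤ _ _ _
  cube-vs-exponential 1 = ≤ᵇ⇒≤ _ _ _
  cube-vs-exponential 2 = ≤ᵇ⇒≤ _ _ _
  cube-vs-exponential 3 = ≤ᵇ⇒≤ _ _ _
  cube-vs-exponential 4 = ≤ᵇ⇒≤ _ _ _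
  cube-vs-exponential 5 = ≤ᵇ⇒≤ _ _ _
  cube-vs-exponential 6 = ≤ᵇ⇒≤ _ _ _
  cube-vs-exponential 7 = ≤ᵇ⇒≤ _ _ _
  cube-vs-exponential m@(suc (suc (suc (suc (suc (suc (suc (suc d)))))))) =
    subst₂ (λ x y → 128 * (x * x * x) * 3456 ^ m ≤ 54000 * y) (reindex d) (sym (^-distribˡ-+-* 4913 8 d))
      (subst (λ z → 128 * ((d + 9) * (d + 9) * (d + 9)) * z ≤ 54000 * (4913 ^ 8 * 4913 ^ d))
        (sym (^-distribˡ-+-* 3456 8 d)) (cube-vs-exponential-from-8 d))
    where reindex : ∀ d → d + 9 ≡ suc (8 + d)
          reindex = solve-∀

  [m*n]^k≡m^k*n^k : ∀ m n k → (m * n) ^ k ≡ m ^ k * n ^ k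
  [m*n]^k≡m^k*n^k m n zero = refl
  [m*n]^k≡m^k*n^k m n (suc k) = trans (cong ((m * n) *_) ([m*n]^k≡m^k*n^k m n k)) (e m n (m ^ k) (n ^ k))
    where e : ∀ a b x y → (a * b) * (x * y) ≡ (a * x) * (b * y)
          e = solve-∀

  cube-^ : ∀ a k → a ^ k * a ^ k * a ^ k ≡ (a * a * a) ^ k
  cube-^ a k = sym (trans ([m*n]^k≡m^k*n^k (a * a) a k) (cong (_* a ^ k) ([m*n]^k≡m^k*n^k a a k)))

  cube-cancel-≤ : ∀ x y → x * x * x ≤ y * y * y → x ≤ y
  cube-cancel-≤ x y h with x ≤? y
  ... | yes x≤y = x≤y
  ... | no x≰y = ⊥-elim (<⇒≱ (*-mono-< (*-mono-< y<x y<x) y<x) h)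
    where y<x = ≰⇒> x≰y

  -- For r < 7k/3 the trivial bound 2^r < (2^(7/3))^k is already below (1 + √2)^(2k) / k; comparing cubes
  -- avoids the cube root.
  crude-bound : ∀ m r → 3 * r < 7 * suc m → suc m * 2 ^ r ≤ 10 * silverRe (double (suc m))
  crude-bound m r 3r<7k = cube-cancel-≤ X Y (*-cancelˡ-≤ (2 * 27 ^ m) {{m*n≢0 2 (27 ^ m) {{_}} {{m^n≢0 27 m}}}} (begin
    (2 * 27 ^ m) * (X * X * X)             ≡⟨ cong ((2 * 27 ^ m) *_) X³ ⟩
    (2 * 27 ^ m) * (k³ * 8 ^ r)            ≡⟨ e₁ (27 ^ m) k³ (8 ^ r) ⟩
    (27 ^ m * k³) * (2 * 8 ^ r)            ≤⟨ *-monoʳ-≤ (27 ^ m * k³) 2·8^r≤128^k ⟩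
    (27 ^ m * k³) * (128 * 128 ^ m)        ≡⟨ e₂ 128 (27 ^ m) k³ (128 ^ m) ⟩
    128 * k³ * (27 ^ m * 128 ^ m)          ≡⟨ cong (128 * k³ *_) ([m*n]^k≡m^k*n^k 27 128 m) ⟨
    128 * k³ * (27 * 128) ^ m              ≤⟨ cube-vs-exponential m ⟩
    54000 * 4913 ^ m                       ≡⟨ cong (54000 *_) (cube-^ 17 m) ⟨
    54000 * (17 ^ m * 17 ^ m * 17 ^ m)     ≡⟨ e₃ 2000 (17 ^ m) ⟩
    2000 * ((3 * 17 ^ m) * (3 * 17 ^ m) * (3 * 17 ^ m))  ≤⟨ *-monoʳ-≤ 2000 (*-mono-≤ (*-mono-≤ lower lower) lower) ⟩
    2000 * ((3 ^ m * P) * (3 ^ m * P) * (3 ^ m * P))     ≡⟨ e₄ 10 (3 ^ m) P ⟩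
    2 * (3 ^ m * 3 ^ m * 3 ^ m) * (Y * Y * Y)            ≡⟨ cong (λ z → 2 * z * (Y * Y * Y)) (cube-^ 3 m) ⟩
    (2 * 27 ^ m) * (Y * Y * Y)             ∎))
    where
      open ≤-Reasoning
      P = silverRe (double (suc m))
      X = suc m * 2 ^ r
      Y = 10 * P
      k³ = suc m * suc m * suc m
      lower = silverRe-lower m
      2·8^r≤128^k : 2 * 8 ^ r ≤ 128 ^ suc m
      2·8^r≤128^k = subst₂ _≤_ (cong (2 *_) (sym (^-*-assoc 2 3 r))) (sym (^-*-assoc 2 7 (suc m)))
                      (^-monoʳ-≤ 2 {suc (3 * r)} {7 * suc m} 3r<7k)
      X³ : X * X * X ≡ k³ * 8 ^ r
      X³ = trans (e (suc m) (2 ^ r)) (cong (k³ *_) (cube-^ 2 r))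
        where e : ∀ a b → (a * b) * (a * b) * (a * b) ≡ (a * a * a) * (b * b * b)
              e = solve-∀
      e₁ : ∀ t c e → (2 * t) * (c * e) ≡ (t * c) * (2 * e)
      e₁ = solve-∀
      e₂ : ∀ u t c x → (t * c) * (u * x) ≡ u * c * (t * x)
      e₂ = solve-∀
      e₃ : ∀ u x → (u * 27) * (x * x * x) ≡ u * ((3 * x) * (3 * x) * (3 * x))
      e₃ = solve-∀
      e₄ : ∀ c t p → (2 * (c * c * c)) * ((t * p) * (t * p) * (t * p)) ≡ 2 * (t * t * t) * ((c * p) * (c * p) * (c * p))
      e₄ = solve-∀

module BallEstimate where

  open import Data.Nat
  open import Data.Nat.Properties
  open import Data.Nat.Combinatorics using (_C_)
  open import Data.Nat.Tactic.RingSolver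
  open import Relation.Binary.PropositionalEquality
  open import Relation.Nullary using (yes; no)
  open SilverRatio using (silverRe)
  open DyadicSums using (double)
  open BinomialWindow using (double≡+)
  open BinomialSquareBound using (binomial-square-bound)
  open HammingBall
  open CrudeBound using (crude-bound)

  ball-square-bound : ∀ r k N → 1 ≤ k → N ≤ hammingBall r k → k * (N * N) ≤ 74 * 74 * silverRe (k + k) * 2 ^ r
  ball-square-bound r k@(suc m) N 1≤k N≤ball with 7 * k ≤? 3 * r
  ... | yes 7k≤3r = begin
    k * (N * N)                                  ≤⟨ *-monoʳ-≤ k (*-mono-≤ N≤4C N≤4C) ⟩
    k * ((4 * (r C k)) * (4 * (r C k)))          ≡⟨ e₁ k (r C k) ⟩
    16 * (k * ((r C k) * (r C k)))               ≤⟨ *-monoʳ-≤ 16 (binomial-square-bound r k 1≤k 7k≤3r) ⟩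
    16 * (336 * silverRe (k + k) * 2 ^ r)        ≡⟨ e₂ 16 336 (silverRe (k + k)) (2 ^ r) ⟩
    16 * 336 * silverRe (k + k) * 2 ^ r          ≤⟨ *-monoˡ-≤ (2 ^ r) (*-monoˡ-≤ (silverRe (k + k)) (≤ᵇ⇒≤ (16 * 336) (74 * 74) _)) ⟩
    74 * 74 * silverRe (k + k) * 2 ^ r           ∎
    where
      open ≤-Reasoning
      N≤4C : N ≤ 4 * (r C k)
      N≤4C = ≤-trans N≤ball (hammingBall≤4C r k 7k≤3r)
      e₁ : ∀ k x → k * ((4 * x) * (4 * x)) ≡ 16 * (k * (x * x))
      e₁ = solve-∀
      e₂ : ∀ a b p q → a * (b * p * q) ≡ a * b * p * q
      e₂ = solve-∀
  ... | no 7k≰3r = begin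
    suc m * (N * N)                              ≤⟨ *-monoʳ-≤ (suc m) (*-mono-≤ N≤2^r N≤2^r) ⟩
    suc m * (2 ^ r * 2 ^ r)                      ≡⟨ *-assoc (suc m) (2 ^ r) (2 ^ r) ⟨
    suc m * 2 ^ r * 2 ^ r                        ≤⟨ *-monoˡ-≤ (2 ^ r) (crude-bound m r (≰⇒> 7k≰3r)) ⟩
    10 * silverRe (double (suc m)) * 2 ^ r       ≡⟨ cong (λ z → 10 * silverRe z * 2 ^ r) (double≡+ (suc m)) ⟩
    10 * silverRe (suc m + suc m) * 2 ^ r        ≤⟨ *-monoˡ-≤ (2 ^ r) (*-monoˡ-≤ (silverRe (suc m + suc m)) (≤ᵇ⇒≤ 10 (74 * 74) _)) ⟩
    74 * 74 * silverRe (suc m + suc m) * 2 ^ r   ∎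
    where
      open ≤-Reasoning
      N≤2^r : N ≤ 2 ^ r
      N≤2^r = ≤-trans N≤ball (hammingBall≤2^r r (suc m))

module BooleanCube where

  open import Data.Bool using (Bool; true; false; _xor_; _∧_)
  open import Data.Bool.Properties using (_≟_; xor-same; xor-assoc; xor-comm)
  open import Data.Nat using (zero; suc)
  open import Data.Product using (Σ; _,_)
  open import Data.Vec using (Vec; []; _∷_; zipWith; replicate)
  open import Relation.Nullary using (yes; no; does)
  open import Relation.Binary.PropositionalEquality

  infixl 6 _⊕_
  _⊕_ : ∀ {n} → Vec Bool n → Vec Bool n → Vec Bool n
  _⊕_ = zipWith _xor_

  0ⁿ : ∀ n → Vec Bool n
  0ⁿ n = replicate n false

  ⊕-comm : ∀ {n} (x y : Vec Bool n) → x ⊕ y ≡ y ⊕ x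
  ⊕-comm [] [] = refl
  ⊕-comm (a ∷ x) (b ∷ y) = cong₂ _∷_ (xor-comm a b) (⊕-comm x y)

  ⊕-assoc : ∀ {n} (x y z : Vec Bool n) → x ⊕ y ⊕ z ≡ x ⊕ (y ⊕ z)
  ⊕-assoc [] [] [] = refl
  ⊕-assoc (a ∷ x) (b ∷ y) (c ∷ z) = cong₂ _∷_ (xor-assoc a b c) (⊕-assoc x y z)

  ⊕-self : ∀ {n} (x : Vec Bool n) → x ⊕ x ≡ 0ⁿ n
  ⊕-self [] = refl
  ⊕-self (a ∷ x) = cong₂ _∷_ (xor-same a) (⊕-self x)

  ⊕-identityʳ : ∀ {n} (x : Vec Bool n) → x ⊕ 0ⁿ n ≡ x
  ⊕-identityʳ [] = refl
  ⊕-identityʳ (false ∷ x) = cong (false ∷_) (⊕-identityʳ x)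
  ⊕-identityʳ (true ∷ x) = cong (true ∷_) (⊕-identityʳ x)

  ⊕-identityˡ : ∀ {n} (x : Vec Bool n) → 0ⁿ n ⊕ x ≡ x
  ⊕-identityˡ x = trans (⊕-comm _ x) (⊕-identityʳ x)

  ⊕-cancelʳ : ∀ {n} (x c : Vec Bool n) → x ⊕ c ⊕ c ≡ x
  ⊕-cancelʳ x c = trans (⊕-assoc x c c) (trans (cong (x ⊕_) (⊕-self c)) (⊕-identityʳ x))

  ∀ᵇ : ∀ n → (Vec Bool n → Bool) → Bool
  ∀ᵇ zero φ = φ []
  ∀ᵇ (suc n) φ = ∀ᵇ n (λ x → φ (false ∷ x)) ∧ ∀ᵇ n (λ x → φ (true ∷ x))

  ∀ᵇ-sound : ∀ n φ → ∀ᵇ n φ ≡ true → ∀ x → φ x ≡ true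
  ∀ᵇ-sound zero φ all [] = all
  ∀ᵇ-sound (suc n) φ all (false ∷ x) with ∀ᵇ n (λ x → φ (false ∷ x)) in first
  ... | true = ∀ᵇ-sound n _ first x
  ∀ᵇ-sound (suc n) φ all (true ∷ x) with ∀ᵇ n (λ x → φ (false ∷ x))
  ... | true = ∀ᵇ-sound n _ all x

  ∀ᵇ-complete : ∀ n φ → (∀ x → φ x ≡ true) → ∀ᵇ n φ ≡ true
  ∀ᵇ-complete zero φ all = all []
  ∀ᵇ-complete (suc n) φ all =
    cong₂ _∧_ (∀ᵇ-complete n _ (λ x → all (false ∷ x))) (∀ᵇ-complete n _ (λ x → all (true ∷ x)))

  ∀ᵇ-counterexample : ∀ n φ → ∀ᵇ n φ ≡ false → Σ (Vec Bool n) λ x → φ x ≡ false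
  ∀ᵇ-counterexample zero φ none = [] , none
  ∀ᵇ-counterexample (suc n) φ none with ∀ᵇ n (λ x → φ (false ∷ x)) in first
  ... | false = let (x , φx) = ∀ᵇ-counterexample n _ first in (false ∷ x) , φx
  ... | true = let (x , φx) = ∀ᵇ-counterexample n _ none in (true ∷ x) , φx

  by-truth-table : ∀ m (l r : Vec Bool m → Bool) → ∀ᵇ m (λ x → does (l x ≟ r x)) ≡ true → ∀ x → l x ≡ r x
  by-truth-table m l r agree x with l x ≟ r x | ∀ᵇ-sound m _ agree x
  ... | yes l≡r | _ = l≡r
  ... | no _ | ()

module CubeSum {A : Set} {_∙_ : A → A → A} {ε : A} (isCM : IsCommutativeMonoid _≡_ _∙_ ε) where

  open import Data.Bool using (Bool; true; false)
  open import Data.Nat using (zero; suc)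
  open import Data.Vec using (Vec; []; _∷_)
  open import Data.List as List using (List; _++_)
  import Data.List.Properties as ListP
  open import Defs using (allVecs)
  open IsCommutativeMonoid isCM using (assoc; comm; identityˡ; identityʳ)
  open BooleanCube using (_⊕_)

  sum : ∀ n → (Vec Bool n → A) → A
  sum zero f = f []
  sum (suc n) f = sum n (λ x → f (false ∷ x)) ∙ sum n (λ x → f (true ∷ x))

  sum-cong : ∀ n {f g : Vec Bool n → A} → (∀ x → f x ≡ g x) → sum n f ≡ sum n g
  sum-cong zero f≗g = f≗g []
  sum-cong (suc n) f≗g = cong₂ _∙_ (sum-cong n (λ x → f≗g (false ∷ x))) (sum-cong n (λ x → f≗g (true ∷ x)))

  sum-translate : ∀ n (f : Vec Bool n → A) c → sum n (λ x → f (x ⊕ c)) ≡ sum n f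
  sum-translate zero f [] = refl
  sum-translate (suc n) f (false ∷ c) =
    cong₂ _∙_ (sum-translate n (λ x → f (false ∷ x)) c) (sum-translate n (λ x → f (true ∷ x)) c)
  sum-translate (suc n) f (true ∷ c) =
    trans (cong₂ _∙_ (sum-translate n (λ x → f (true ∷ x)) c) (sum-translate n (λ x → f (false ∷ x)) c)) (comm _ _)

  sum-∙ : ∀ n (f g : Vec Bool n → A) → sum n (λ x → f x ∙ g x) ≡ sum n f ∙ sum n g
  sum-∙ zero f g = refl
  sum-∙ (suc n) f g =
    trans (cong₂ _∙_ (sum-∙ n (λ x → f (false ∷ x)) (λ x → g (false ∷ x))) (sum-∙ n (λ x → f (true ∷ x)) (λ x → g (true ∷ x))))
          (interchange _ _ _ _)
    where
      interchange : ∀ a b c d → (a ∙ b) ∙ (c ∙ d) ≡ (a ∙ c) ∙ (b ∙ d)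
      interchange a b c d = begin
        (a ∙ b) ∙ (c ∙ d)   ≡⟨ assoc a b (c ∙ d) ⟩
        a ∙ (b ∙ (c ∙ d))   ≡⟨ cong (a ∙_) (assoc b c d) ⟨
        a ∙ ((b ∙ c) ∙ d)   ≡⟨ cong (λ z → a ∙ (z ∙ d)) (comm b c) ⟩
        a ∙ ((c ∙ b) ∙ d)   ≡⟨ cong (a ∙_) (assoc c b d) ⟩
        a ∙ (c ∙ (b ∙ d))   ≡⟨ assoc a c (b ∙ d) ⟨
        (a ∙ c) ∙ (b ∙ d)   ∎
        where open ≡-Reasoning

  sum-ε : ∀ n → sum n (λ _ → ε) ≡ ε
  sum-ε zero = refl
  sum-ε (suc n) = trans (cong₂ _∙_ (sum-ε n) (sum-ε n)) (identityʳ ε)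

  sum-swap : ∀ n m (f : Vec Bool n → Vec Bool m → A) → sum n (λ x → sum m (f x)) ≡ sum m (λ y → sum n (λ x → f x y))
  sum-swap zero m f = refl
  sum-swap (suc n) m f =
    trans (cong₂ _∙_ (sum-swap n m (λ x → f (false ∷ x))) (sum-swap n m (λ x → f (true ∷ x))))
          (sym (sum-∙ m (λ y → sum n (λ x → f (false ∷ x) y)) (λ y → sum n (λ x → f (true ∷ x) y))))

  foldr-++ : ∀ xs ys → List.foldr _∙_ ε (xs ++ ys) ≡ List.foldr _∙_ ε xs ∙ List.foldr _∙_ ε ys
  foldr-++ List.[] ys = sym (identityˡ _)
  foldr-++ (x List.∷ xs) ys = trans (cong (x ∙_) (foldr-++ xs ys)) (sym (assoc x _ _))

  foldr-allVecs : ∀ n (f : Vec Bool n → A) → List.foldr _∙_ ε (List.map f (allVecs n)) ≡ sum n f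
  foldr-allVecs zero f = identityʳ (f [])
  foldr-allVecs (suc n) f = begin
    List.foldr _∙_ ε (List.map f (List.map (false ∷_) (allVecs n) ++ List.map (true ∷_) (allVecs n)))
      ≡⟨ cong (List.foldr _∙_ ε) (ListP.map-++ f (List.map (false ∷_) (allVecs n)) _) ⟩
    List.foldr _∙_ ε (List.map f (List.map (false ∷_) (allVecs n)) ++ List.map f (List.map (true ∷_) (allVecs n)))
      ≡⟨ foldr-++ (List.map f (List.map (false ∷_) (allVecs n))) _ ⟩
    List.foldr _∙_ ε (List.map f (List.map (false ∷_) (allVecs n))) ∙ List.foldr _∙_ ε (List.map f (List.map (true ∷_) (allVecs n)))
      ≡⟨ cong₂ _∙_ (cong (List.foldr _∙_ ε) (sym (ListP.map-∘ (allVecs n)))) (cong (List.foldr _∙_ ε) (sym (ListP.map-∘ (allVecs n)))) ⟩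
    List.foldr _∙_ ε (List.map (λ x → f (false ∷ x)) (allVecs n)) ∙ List.foldr _∙_ ε (List.map (λ x → f (true ∷ x)) (allVecs n))
      ≡⟨ cong₂ _∙_ (foldr-allVecs n _) (foldr-allVecs n _) ⟩
    sum (suc n) f ∎
    where open ≡-Reasoning

module AffineSubspaces where

  open import Data.Bool using (Bool; true; false; _∧_)
  open import Data.Bool.Properties using (∧-zeroʳ)
  open import Data.Nat as ℕ using (ℕ; zero; suc; _+_; _^_; _≤_; z≤n; s≤s)
  import Data.Nat.Properties as ℕP
  open import Data.Empty using (⊥-elim)
  open import Data.Fin.Subset using (∣_∣)
  open import Data.Product using (Σ; _×_; _,_; proj₁; proj₂)
  open import Data.Vec using (Vec; []; _∷_)
  open import Relation.Nullary using (yes; no)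
  open import Relation.Binary.Definitions using (tri<; tri≈; tri>)
  open import Relation.Binary.PropositionalEquality
  open BooleanCube
  open HammingBall using (hammingBall; hammingBall-pos; hammingBall-suc)
  module Σℕ = CubeSum ℕP.+-0-isCommutativeMonoid

  indicator : Bool → ℕ
  indicator true = 1
  indicator false = 0

  count : ∀ n → (Vec Bool n → Bool) → ℕ
  count n P = Σℕ.sum n (λ x → indicator (P x))

  countOfWeight : ∀ n → (Vec Bool n → Bool) → ℕ → ℕ
  countOfWeight n S k = count n (λ x → S x ∧ (∣ x ∣ ℕ.≡ᵇ k))

  -- Nonempty affine subspaces are exactly the nonempty sets closed under x + y + z.
  Affine : ∀ {n} → (Vec Bool n → Bool) → Set
  Affine {n} S = ∀ x y z → S x ≡ true → S y ≡ true → S z ≡ true → S (x ⊕ y ⊕ z) ≡ true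

  sum-mono : ∀ n {f g : Vec Bool n → ℕ} → (∀ x → f x ≤ g x) → Σℕ.sum n f ≤ Σℕ.sum n g
  sum-mono zero f≤g = f≤g []
  sum-mono (suc n) f≤g = ℕP.+-mono-≤ (sum-mono n (λ x → f≤g (false ∷ x))) (sum-mono n (λ x → f≤g (true ∷ x)))

  indicator-∧ : ∀ a b → indicator (a ∧ b) ≤ indicator a
  indicator-∧ false b = z≤n
  indicator-∧ true false = z≤n
  indicator-∧ true true = ℕP.≤-refl

  count-∧≤ : ∀ n (S P : Vec Bool n → Bool) → count n (λ x → S x ∧ P x) ≤ count n S
  count-∧≤ n S P = sum-mono n (λ x → indicator-∧ (S x) (P x))

  count-pos : ∀ n P x → P x ≡ true → 1 ≤ count n P
  count-pos zero P [] Px = subst (λ b → 1 ≤ indicator b) (sym Px) ℕP.≤-refl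
  count-pos (suc n) P (false ∷ x) Px = ℕP.≤-trans (count-pos n (λ x → P (false ∷ x)) x Px) (ℕP.m≤m+n _ _)
  count-pos (suc n) P (true ∷ x) Px = ℕP.≤-trans (count-pos n (λ x → P (true ∷ x)) x Px) (ℕP.m≤n+m _ _)

  count-witness : ∀ n P → 1 ≤ count n P → Σ (Vec Bool n) λ x → P x ≡ true
  count-witness zero P pos with P [] in Px
  ... | true = [] , Px
  count-witness (suc n) P pos with count n (λ x → P (false ∷ x)) ℕ.≟ 0
  ... | no ≢0 = let (x , Px) = count-witness n (λ x → P (false ∷ x)) (ℕP.n≢0⇒n>0 ≢0) in (false ∷ x) , Px
  ... | yes ≡0 = let (x , Px) = count-witness n (λ x → P (true ∷ x)) (subst (λ t → 1 ≤ t + count n (λ x → P (true ∷ x))) ≡0 pos) in (true ∷ x) , Px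

  count-cong : ∀ n {P Q : Vec Bool n → Bool} → (∀ x → P x ≡ Q x) → count n P ≡ count n Q
  count-cong n P≗Q = Σℕ.sum-cong n (λ x → cong indicator (P≗Q x))

  2^-injective : ∀ a b → 2 ^ a ≡ 2 ^ b → a ≡ b
  2^-injective a b eq with ℕP.<-cmp a b
  ... | tri< a<b _ _ = ⊥-elim (ℕP.<-irrefl eq (ℕP.^-monoʳ-< 2 (s≤s (s≤s z≤n)) a<b))
  ... | tri≈ _ a≡b _ = a≡b
  ... | tri> _ _ a>b = ⊥-elim (ℕP.<-irrefl (sym eq) (ℕP.^-monoʳ-< 2 (s≤s (s≤s z≤n)) a>b))

  bool-ext : ∀ {a b : Bool} → (a ≡ true → b ≡ true) → (b ≡ true → a ≡ true) → a ≡ b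
  bool-ext {false} {false} _ _ = refl
  bool-ext {false} {true} _ b⇒a = b⇒a refl
  bool-ext {true} {false} a⇒b _ = sym (a⇒b refl)
  bool-ext {true} {true} _ _ = refl

  NonEmpty : ∀ {n} → (Vec Bool n → Bool) → Set
  NonEmpty {n} S = Σ (Vec Bool n) λ x → S x ≡ true

  AffineCounts : ∀ {n} → (Vec Bool n → Bool) → Set
  AffineCounts {n} S = Σ ℕ λ r → count n S ≡ 2 ^ r × (∀ k → countOfWeight n S k ≤ hammingBall r k)

  module Step {n} (IH : ∀ (S : Vec Bool n → Bool) → Affine S → NonEmpty S → AffineCounts S)
                  (S : Vec Bool (suc n) → Bool) (affine : Affine S) where

    private
      S₀ S₁ : Vec Bool n → Bool
      S₀ x = S (false ∷ x)
      S₁ x = S (true ∷ x)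

      affine₀ : Affine S₀
      affine₀ x y z = affine (false ∷ x) (false ∷ y) (false ∷ z)

      affine₁ : Affine S₁
      affine₁ x y z = affine (true ∷ x) (true ∷ y) (true ∷ z)

      weight-zero-upper : count n (λ x → S₁ x ∧ false) ≡ 0
      weight-zero-upper = trans (count-cong n (λ x → ∧-zeroʳ (S₁ x))) (Σℕ.sum-ε n)

    halves-translate : ∀ a b → S₀ a ≡ true → S₁ b ≡ true → ∀ x → S₁ (x ⊕ (a ⊕ b)) ≡ S₀ x
    halves-translate a b S₀a S₁b x = bool-ext
      (λ S₁x′ → subst (λ z → S₀ z ≡ true) (cancel x a b) (affine (true ∷ (x ⊕ (a ⊕ b))) (true ∷ b) (false ∷ a) S₁x′ S₁b S₀a))
      (λ S₀x → subst (λ z → S₁ z ≡ true) (⊕-assoc x a b) (affine (false ∷ x) (false ∷ a) (true ∷ b) S₀x S₀a S₁b))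
      where
        cancel : ∀ x a b → x ⊕ (a ⊕ b) ⊕ b ⊕ a ≡ x
        cancel x a b = trans (cong (_⊕ a) (trans (⊕-assoc x (a ⊕ b) b) (cong (x ⊕_) (⊕-cancelʳ a b)))) (⊕-cancelʳ x a)

    lower-empty : count n S₀ ≡ 0 → NonEmpty S → AffineCounts S
    lower-empty empty₀ (false ∷ x , S₀x) = ⊥-elim (ℕP.<-irrefl (sym empty₀) (count-pos n S₀ x S₀x))
    lower-empty empty₀ (true ∷ x , S₁x) = r , trans (cong (_+ count n S₁) empty₀) (proj₁ counted) , bound
      where
        open Σ (IH S₁ affine₁ (x , S₁x)) renaming (proj₁ to r; proj₂ to counted)
        lower≤0 : ∀ k → countOfWeight n S₀ k ≤ 0
        lower≤0 k = ℕP.≤-trans (count-∧≤ n S₀ (λ x → ∣ x ∣ ℕ.≡ᵇ k)) (ℕP.≤-reflexive empty₀)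
        bound : ∀ k → countOfWeight (suc n) S k ≤ hammingBall r k
        bound zero = ℕP.≤-trans (ℕP.+-mono-≤ (lower≤0 0) (ℕP.≤-reflexive weight-zero-upper)) z≤n
        bound (suc k) = ℕP.+-mono-≤ (lower≤0 (suc k)) (ℕP.≤-trans (proj₂ counted k) (ℕP.m≤n+m _ _))

    upper-empty : NonEmpty S₀ → count n S₁ ≡ 0 → AffineCounts S
    upper-empty nonempty₀ empty₁ =
      r , trans (cong (count n S₀ +_) empty₁) (trans (ℕP.+-identityʳ _) (proj₁ counted)) , bound
      where
        open Σ (IH S₀ affine₀ nonempty₀) renaming (proj₁ to r; proj₂ to counted)
        bound : ∀ k → countOfWeight (suc n) S k ≤ hammingBall r k
        bound k = ℕP.≤-trans (ℕP.+-mono-≤ (proj₂ counted k) (ℕP.≤-trans (count-∧≤ n S₁ (λ x → ∣ true ∷ x ∣ ℕ.≡ᵇ k)) (ℕP.≤-reflexive empty₁)))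
                             (ℕP.≤-reflexive (ℕP.+-identityʳ _))

    both-nonempty : NonEmpty S₀ → NonEmpty S₁ → AffineCounts S
    both-nonempty (a , S₀a) (b , S₁b) = suc r , count-eq , bound
      where
        open Σ (IH S₀ affine₀ (a , S₀a)) renaming (proj₁ to r; proj₂ to counted₀)
        open Σ (IH S₁ affine₁ (b , S₁b)) renaming (proj₁ to r₁; proj₂ to counted₁)
        same : count n S₁ ≡ count n S₀
        same = trans (sym (Σℕ.sum-translate n (λ x → indicator (S₁ x)) (a ⊕ b))) (count-cong n (halves-translate a b S₀a S₁b))
        r₁≡r : r₁ ≡ r
        r₁≡r = 2^-injective r₁ r (trans (sym (proj₁ counted₁)) (trans same (proj₁ counted₀)))
        count-eq : count n S₀ + count n S₁ ≡ 2 ^ suc r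
        count-eq = trans (cong₂ _+_ (proj₁ counted₀) (trans same (proj₁ counted₀))) (cong (2 ^ r +_) (sym (ℕP.+-identityʳ (2 ^ r))))
        bound : ∀ k → countOfWeight (suc n) S k ≤ hammingBall (suc r) k
        bound zero = ℕP.+-mono-≤ (proj₂ counted₀ 0) (ℕP.≤-reflexive weight-zero-upper)
        bound (suc k) = ℕP.≤-trans (ℕP.+-mono-≤ (proj₂ counted₀ (suc k)) (subst (λ t → countOfWeight n S₁ k ≤ hammingBall t k) r₁≡r (proj₂ counted₁ k)))
                                   (ℕP.≤-reflexive (sym (hammingBall-suc r k)))

  affine-count : ∀ n (S : Vec Bool n → Bool) → Affine S → NonEmpty S → AffineCounts S
  affine-count zero S _ ([] , S[]) = 0 , cong indicator S[] , λ k → ℕP.≤-trans (indicator≤1 _) (hammingBall-pos 0 k)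
    where indicator≤1 : ∀ b → indicator b ≤ 1
          indicator≤1 false = z≤n
          indicator≤1 true = ℕP.≤-refl
  affine-count (suc n) S affine nonempty
    with count n (λ x → S (false ∷ x)) ℕ.≟ 0 | count n (λ x → S (true ∷ x)) ℕ.≟ 0
  ... | yes empty₀ | _ = Step.lower-empty (affine-count n) S affine empty₀ nonempty
  ... | no nonempty₀ | yes empty₁ =
    Step.upper-empty (affine-count n) S affine (count-witness n _ (ℕP.n≢0⇒n>0 nonempty₀)) empty₁
  ... | no nonempty₀ | no nonempty₁ =
    Step.both-nonempty (affine-count n) S affine (count-witness n _ (ℕP.n≢0⇒n>0 nonempty₀)) (count-witness n _ (ℕP.n≢0⇒n>0 nonempty₁))

module ThirdDifference where

  open import Data.Bool using (Bool; true; false; _xor_; _∧_)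
  open import Data.Bool.Properties using (∧-distribˡ-xor; ∧-comm)
  open import Data.Fin using (Fin)
  open import Data.Nat using (zero; suc)
  open import Data.Product using (_,_)
  open import Data.Vec using (Vec; []; _∷_; zipWith; lookup; foldr; tabulate)
  open import Data.Vec.Properties using (lookup-zipWith; lookup-replicate)
  open import Relation.Binary.PropositionalEquality
  open import Defs using (xA; quadEval; DegreeAtMost2)
  open BooleanCube

  xor-interchange : ∀ a b c d → (a xor b) xor (c xor d) ≡ (a xor c) xor (b xor d)
  xor-interchange a b c d = by-truth-table 4
    (λ { (a ∷ b ∷ c ∷ d ∷ []) → (a xor b) xor (c xor d) })
    (λ { (a ∷ b ∷ c ∷ d ∷ []) → (a xor c) xor (b xor d) }) refl (a ∷ b ∷ c ∷ d ∷ [])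

  xA-additive : ∀ {n} (A x y : Vec Bool n) → xA A (x ⊕ y) ≡ xA A x xor xA A y
  xA-additive [] [] [] = refl
  xA-additive (a ∷ A) (u ∷ x) (v ∷ y) =
    trans (cong₂ _xor_ (∧-distribˡ-xor a u v) (xA-additive A x y)) (xor-interchange (a ∧ u) (a ∧ v) (xA A x) (xA A y))

  xA-comm : ∀ {n} (A x : Vec Bool n) → xA A x ≡ xA x A
  xA-comm [] [] = refl
  xA-comm (a ∷ A) (u ∷ x) = cong₂ _xor_ (∧-comm a u) (xA-comm A x)

  xA-zero : ∀ {n} (A : Vec Bool n) → xA A (0ⁿ n) ≡ false
  xA-zero [] = refl
  xA-zero (false ∷ A) = xA-zero A
  xA-zero (true ∷ A) = xA-zero A

  -- Δ³ f x y h = Σ_{S ⊆ {x, y, h}} f(Σ S), which vanishes identically iff deg f ≤ 2.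
  Δ³ : ∀ {n} → (Vec Bool n → Bool) → Vec Bool n → Vec Bool n → Vec Bool n → Bool
  Δ³ {n} f x y h = ((f (x ⊕ y ⊕ h) xor f (x ⊕ y)) xor (f (x ⊕ h) xor f (y ⊕ h))) xor ((f x xor f y) xor (f h xor f (0ⁿ n)))

  Δ³-cong : ∀ {n} {f g : Vec Bool n → Bool} → (∀ z → f z ≡ g z) → ∀ x y h → Δ³ f x y h ≡ Δ³ g x y h
  Δ³-cong {n} f≗g x y h
    rewrite f≗g (x ⊕ y ⊕ h) | f≗g (x ⊕ y) | f≗g (x ⊕ h) | f≗g (y ⊕ h) | f≗g x | f≗g y | f≗g h | f≗g (0ⁿ n) = refl

  Δ³-xor : ∀ {n} (f g : Vec Bool n → Bool) x y h → Δ³ (λ z → f z xor g z) x y h ≡ Δ³ f x y h xor Δ³ g x y h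
  Δ³-xor {n} f g x y h =
    trans (cong₂ _xor_ (trans (cong₂ _xor_ (xor-interchange (f p₁) (g p₁) (f p₂) (g p₂)) (xor-interchange (f p₃) (g p₃) (f p₄) (g p₄)))
                              (xor-interchange (f p₁ xor f p₂) (g p₁ xor g p₂) (f p₃ xor f p₄) (g p₃ xor g p₄)))
                       (trans (cong₂ _xor_ (xor-interchange (f x) (g x) (f y) (g y)) (xor-interchange (f h) (g h) (f p₀) (g p₀)))
                              (xor-interchange (f x xor f y) (g x xor g y) (f h xor f p₀) (g h xor g p₀))))
          (xor-interchange (Δ₁ f) (Δ₁ g) (Δ₂ f) (Δ₂ g))
    where
      p₀ = 0ⁿ n
      p₁ = x ⊕ y ⊕ h
      p₂ = x ⊕ y
      p₃ = x ⊕ h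
      p₄ = y ⊕ h
      Δ₁ Δ₂ : (Vec Bool n → Bool) → Bool
      Δ₁ f = (f p₁ xor f p₂) xor (f p₃ xor f p₄)
      Δ₂ f = (f x xor f y) xor (f h xor f p₀)

  Δ³-const : ∀ {n} (c : Bool) x y h → Δ³ {n} (λ _ → c) x y h ≡ false
  Δ³-const false x y h = refl
  Δ³-const true x y h = refl

  Δ³-additive : ∀ {n} (f : Vec Bool n → Bool) → (∀ x y → f (x ⊕ y) ≡ f x xor f y) → f (0ⁿ n) ≡ false →
    ∀ x y h → Δ³ f x y h ≡ false
  Δ³-additive {n} f additive f0 x y h =
    trans (cong₂ _xor_ (cong₂ _xor_ (cong₂ _xor_ (trans (additive (x ⊕ y) h) (cong (_xor f h) (additive x y))) (additive x y))
                                     (cong₂ _xor_ (additive x h) (additive y h)))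
                        (cong (λ z → (f x xor f y) xor (f h xor z)) f0))
          (by-truth-table 3
            (λ { (a ∷ b ∷ c ∷ []) → ((((a xor b) xor c) xor (a xor b)) xor ((a xor c) xor (b xor c))) xor ((a xor b) xor (c xor false)) })
            (λ _ → false) refl (f x ∷ f y ∷ f h ∷ []))

  bigXor : ∀ {m} → Vec Bool m → Bool
  bigXor = foldr _ _xor_ false

  Δ³-bigXor : ∀ {n} m (G : Fin m → Vec Bool n → Bool) x y h →
    Δ³ (λ z → bigXor (tabulate (λ i → G i z))) x y h ≡ bigXor (tabulate (λ i → Δ³ (G i) x y h))
  Δ³-bigXor zero G x y h = refl
  Δ³-bigXor (suc m) G x y h = trans (Δ³-xor (G Fin.zero) (λ z → bigXor (tabulate (λ i → G (Fin.suc i) z))) x y h)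
                                     (cong (Δ³ (G Fin.zero) x y h xor_) (Δ³-bigXor m (λ i → G (Fin.suc i)) x y h))

  bigXor-false : ∀ m (g : Fin m → Bool) → (∀ i → g i ≡ false) → bigXor (tabulate g) ≡ false
  bigXor-false zero g _ = refl
  bigXor-false (suc m) g g≡false = cong₂ _xor_ (g≡false Fin.zero) (bigXor-false m (λ i → g (Fin.suc i)) (λ i → g≡false (Fin.suc i)))

  Δ³-monomial : ∀ {n} (c : Bool) (i j : Fin n) x y h → Δ³ (λ z → c ∧ (lookup z i ∧ lookup z j)) x y h ≡ false
  Δ³-monomial {n} c i j x y h
    rewrite lookup-zipWith _xor_ i (zipWith _xor_ x y) h | lookup-zipWith _xor_ j (zipWith _xor_ x y) h
          | lookup-zipWith _xor_ i x y | lookup-zipWith _xor_ j x y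
          | lookup-zipWith _xor_ i x h | lookup-zipWith _xor_ j x h
          | lookup-zipWith _xor_ i y h | lookup-zipWith _xor_ j y h
          | lookup-replicate {n = n} i false
    = by-truth-table 7
        (λ { (c ∷ xi ∷ yi ∷ hi ∷ xj ∷ yj ∷ hj ∷ []) → let m = λ u v → c ∧ (u ∧ v) in
               ((m ((xi xor yi) xor hi) ((xj xor yj) xor hj) xor m (xi xor yi) (xj xor yj)) xor
                (m (xi xor hi) (xj xor hj) xor m (yi xor hi) (yj xor hj))) xor
               ((m xi xj xor m yi yj) xor (m hi hj xor m false false)) })
        (λ _ → false) refl (c ∷ lookup x i ∷ lookup y i ∷ lookup h i ∷ lookup x j ∷ lookup y j ∷ lookup h j ∷ [])

  Δ³-quadEval : ∀ {n} c (a : Vec Bool n) b x y h → Δ³ (quadEval c a b) x y h ≡ false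
  Δ³-quadEval {n} c a b x y h =
    trans (Δ³-xor (λ _ → c) (λ z → xA a z xor quadratic z) x y h)
          (cong₂ _xor_ (Δ³-const c x y h)
            (trans (Δ³-xor (xA a) quadratic x y h)
                   (cong₂ _xor_ (Δ³-additive (xA a) (xA-additive a) (xA-zero a) x y h) quadratic-Δ³)))
    where
      quadratic : Vec Bool n → Bool
      quadratic z = bigXor (tabulate {n = n} λ i → bigXor (tabulate {n = n} λ j → b i j ∧ lookup z i ∧ lookup z j))
      quadratic-Δ³ : Δ³ quadratic x y h ≡ false
      quadratic-Δ³ =
        trans (Δ³-bigXor n (λ i z → bigXor (tabulate {n = n} λ j → b i j ∧ lookup z i ∧ lookup z j)) x y h)
              (bigXor-false n _ (λ i → trans (Δ³-bigXor n (λ j z → b i j ∧ lookup z i ∧ lookup z j) x y h)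
                                             (bigXor-false n _ (λ j → Δ³-monomial (b i j) i j x y h))))

  Δ³-degree≤2 : ∀ {n} (p : Vec Bool n → Bool) → DegreeAtMost2 p → ∀ x y h → Δ³ p x y h ≡ false
  Δ³-degree≤2 p (c , a , b , p≗) x y h = trans (Δ³-cong p≗ x y h) (Δ³-quadEval c a b x y h)

module Characters where

  open import Data.Bool using (Bool; true; false; _xor_; not)
  open import Data.Nat as ℕ using (ℕ; zero; suc)
  open import Data.Integer as ℤ using (ℤ; +_; -_; -[1+_])
  import Data.Integer.Properties as ℤP
  open import Data.Integer.Tactic.RingSolver using (solve-∀)
  open import Data.Vec using (Vec; []; _∷_)
  open import Relation.Binary.PropositionalEquality
  open import Defs using (xA; sign)
  open BooleanCube
  open AffineSubspaces using (indicator; module Σℕ)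
  module Σℤ = CubeSum ℤP.+-0-isCommutativeMonoid

  sign-xor : ∀ a b → sign (a xor b) ≡ sign a ℤ.* sign b
  sign-xor false false = refl
  sign-xor false true = refl
  sign-xor true false = refl
  sign-xor true true = refl

  sign-not : ∀ b → sign (not b) ≡ - sign b
  sign-not false = refl
  sign-not true = refl

  s≡-s⇒s≡0 : ∀ (s : ℤ) → s ≡ - s → s ≡ + 0
  s≡-s⇒s≡0 (+ zero) _ = refl
  s≡-s⇒s≡0 (+ suc n) ()
  s≡-s⇒s≡0 -[1+ n ] ()

  sum-*ˡ : ∀ n c (f : Vec Bool n → ℤ) → Σℤ.sum n (λ x → c ℤ.* f x) ≡ c ℤ.* Σℤ.sum n f
  sum-*ˡ zero c f = refl
  sum-*ˡ (suc n) c f =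
    trans (cong₂ ℤ._+_ (sum-*ˡ n c (λ x → f (false ∷ x))) (sum-*ˡ n c (λ x → f (true ∷ x)))) (sym (ℤP.*-distribˡ-+ c _ _))

  sum-*ʳ : ∀ n c (f : Vec Bool n → ℤ) → Σℤ.sum n (λ x → f x ℤ.* c) ≡ Σℤ.sum n f ℤ.* c
  sum-*ʳ n c f = trans (Σℤ.sum-cong n (λ x → ℤP.*-comm (f x) c)) (trans (sum-*ˡ n c f) (ℤP.*-comm c _))

  sum-neg : ∀ n (f : Vec Bool n → ℤ) → Σℤ.sum n (λ x → - f x) ≡ - Σℤ.sum n f
  sum-neg zero f = refl
  sum-neg (suc n) f =
    trans (cong₂ ℤ._+_ (sum-neg n (λ x → f (false ∷ x))) (sum-neg n (λ x → f (true ∷ x))))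
          (sym (ℤP.neg-distrib-+ (Σℤ.sum n (λ x → f (false ∷ x))) (Σℤ.sum n (λ x → f (true ∷ x)))))

  sum-ℕ : ∀ n (f : Vec Bool n → ℕ) → Σℤ.sum n (λ x → + f x) ≡ + Σℕ.sum n f
  sum-ℕ zero f = refl
  sum-ℕ (suc n) f = trans (cong₂ ℤ._+_ (sum-ℕ n (λ x → f (false ∷ x))) (sum-ℕ n (λ x → f (true ∷ x))))
          (sym (ℤP.pos-+ (Σℕ.sum n (λ x → f (false ∷ x))) (Σℕ.sum n (λ x → f (true ∷ x)))))

  sum-const : ∀ n c → Σℤ.sum n (λ _ → c) ≡ + (2 ℕ.^ n) ℤ.* c
  sum-const zero c = sym (ℤP.*-identityˡ c)
  sum-const (suc n) c =
    trans (cong₂ ℤ._+_ (sum-const n c) (sum-const n c)) (trans (double (+ (2 ℕ.^ n)) c) (cong (ℤ._* c) (sym (ℤP.pos-* 2 (2 ℕ.^ n)))))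
    where double : ∀ a c → a ℤ.* c ℤ.+ a ℤ.* c ≡ (+ 2 ℤ.* a) ℤ.* c
          double = solve-∀

  sum-product : ∀ n (f g : Vec Bool n → ℤ) → Σℤ.sum n f ℤ.* Σℤ.sum n g ≡ Σℤ.sum n (λ x → Σℤ.sum n (λ y → f x ℤ.* g y))
  sum-product n f g = trans (sym (sum-*ʳ n (Σℤ.sum n g) f)) (Σℤ.sum-cong n (λ x → sym (sum-*ˡ n (f x) g)))

  sum-sign-false : ∀ n (φ : Vec Bool n → Bool) → (∀ x → φ x ≡ false) → Σℤ.sum n (λ x → sign (φ x)) ≡ + (2 ℕ.^ n)
  sum-sign-false n φ φ≡false = trans (Σℤ.sum-cong n (λ x → cong sign (φ≡false x))) (trans (sum-const n (+ 1)) (ℤP.*-identityʳ _))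

  -- A nontrivial additive character sums to zero: translating by a point where it is 1 negates the sum.
  sum-sign-additive : ∀ n (φ : Vec Bool n → Bool) → (∀ x y → φ (x ⊕ y) ≡ φ x xor φ y) → ∀ x₀ → φ x₀ ≡ true →
    Σℤ.sum n (λ x → sign (φ x)) ≡ + 0
  sum-sign-additive n φ additive x₀ φx₀ = s≡-s⇒s≡0 _ (begin
    Σℤ.sum n (λ x → sign (φ x))             ≡⟨ Σℤ.sum-translate n (λ x → sign (φ x)) x₀ ⟨
    Σℤ.sum n (λ x → sign (φ (x ⊕ x₀)))      ≡⟨ Σℤ.sum-cong n (λ x → trans (cong sign (trans (additive x x₀) (cong (φ x xor_) φx₀))) (sign-xor-true (φ x))) ⟩
    Σℤ.sum n (λ x → - sign (φ x))           ≡⟨ sum-neg n _ ⟩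
    - Σℤ.sum n (λ x → sign (φ x))           ∎)
    where
      open ≡-Reasoning
      sign-xor-true : ∀ b → sign (b xor true) ≡ - sign b
      sign-xor-true false = refl
      sign-xor-true true = refl

  isZero : ∀ {n} → Vec Bool n → Bool
  isZero [] = true
  isZero (false ∷ x) = isZero x
  isZero (true ∷ x) = false

  sum-sign-xA : ∀ n (h : Vec Bool n) → Σℤ.sum n (λ A → sign (xA A h)) ≡ + (2 ℕ.^ n) ℤ.* + indicator (isZero h)
  sum-sign-xA zero [] = refl
  sum-sign-xA (suc n) (false ∷ h) =
    trans (cong₂ ℤ._+_ (sum-sign-xA n h) (sum-sign-xA n h)) (trans (double (+ (2 ℕ.^ n)) (+ indicator (isZero h))) (cong (ℤ._* + indicator (isZero h)) (sym (ℤP.pos-* 2 (2 ℕ.^ n)))))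
    where double : ∀ a b → a ℤ.* b ℤ.+ a ℤ.* b ≡ (+ 2 ℤ.* a) ℤ.* b
          double = solve-∀
  sum-sign-xA (suc n) (true ∷ h) =
    trans (cong (λ t → s ℤ.+ t) (trans (Σℤ.sum-cong n (λ A → sign-not (xA A h))) (sum-neg n (λ A → sign (xA A h)))))
          (trans (ℤP.+-inverseʳ s) (sym (ℤP.*-zeroʳ (+ (2 ℕ.^ suc n)))))
    where s = Σℤ.sum n (λ A → sign (xA A h))

  sum-at-zero : ∀ n (v : Vec Bool n → ℤ) → Σℤ.sum n (λ h → + indicator (isZero h) ℤ.* v h) ≡ v (0ⁿ n)
  sum-at-zero zero v = ℤP.*-identityˡ (v [])
  sum-at-zero (suc n) v =
    trans (cong₂ ℤ._+_ (sum-at-zero n (λ h → v (false ∷ h)))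
                       (trans (Σℤ.sum-cong n (λ h → ℤP.*-zeroˡ (v (true ∷ h)))) (Σℤ.sum-ε n)))
          (ℤP.+-identityʳ _)

module QuadraticSpectrum {n : ℕ} (Q : Vec Bool n → Bool) (Δ³Q≡false : ∀ x y h → ThirdDifference.Δ³ Q x y h ≡ false) where

  open import Data.Bool using (Bool; true; false; _xor_; _∨_; not)
  open import Data.Bool.Properties using (xor-same; xor-identityʳ)
  import Data.Nat as ℕ
  open import Data.Integer as ℤ using (ℤ; +_; -_)
  import Data.Integer.Properties as ℤP
  open import Data.Integer.Tactic.RingSolver using (solve-∀)
  open import Data.Product using (_,_; proj₁; proj₂)
  open import Data.Vec using (Vec; _∷_; [])
  open import Defs using (xA; sign)
  open BooleanCube
  open ThirdDifference using (xA-additive; xA-comm; xor-interchange)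
  open AffineSubspaces using (indicator; count; Affine; bool-ext)
  open Characters

  private
    Q₀ = Q (0ⁿ n)

    not-true : ∀ {b} → not b ≡ true → b ≡ false
    not-true {false} _ = refl

    xor-by-false : ∀ {a b c} → a ≡ b xor c → c ≡ false → a ≡ b
    xor-by-false {b = b} a≡ c≡false = trans a≡ (trans (cong (b xor_) c≡false) (xor-identityʳ b))

  -- The polarization B h x = Q(x + h) + Q(x) + Q(h) + Q(0), a symmetric bilinear form since Δ³ Q = 0.
  B : Vec Bool n → Vec Bool n → Bool
  B h x = (Q (x ⊕ h) xor Q x) xor (Q h xor Q₀)

  B-additive : ∀ h x y → B h (x ⊕ y) ≡ B h x xor B h y
  B-additive h x y = xor-by-false
    (by-truth-table 8
      (λ { (a ∷ b ∷ c ∷ d ∷ e ∷ f ∷ g ∷ k ∷ []) → (a xor b) xor (g xor k) })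
      (λ { (a ∷ b ∷ c ∷ d ∷ e ∷ f ∷ g ∷ k ∷ []) →
           (((c xor e) xor (g xor k)) xor ((d xor f) xor (g xor k))) xor (((a xor b) xor (c xor d)) xor ((e xor f) xor (g xor k))) })
      refl (Q (x ⊕ y ⊕ h) ∷ Q (x ⊕ y) ∷ Q (x ⊕ h) ∷ Q (y ⊕ h) ∷ Q x ∷ Q y ∷ Q h ∷ Q₀ ∷ []))
    (Δ³Q≡false x y h)

  B-comm : ∀ h x → B h x ≡ B x h
  B-comm h x = trans (xor-interchange (Q (x ⊕ h)) (Q x) (Q h) Q₀) (cong (λ z → (Q z xor Q h) xor (Q x xor Q₀)) (⊕-comm x h))

  B-zero : ∀ h → B h (0ⁿ n) ≡ false
  B-zero h = trans (cong (λ z → (Q z xor Q₀) xor (Q h xor Q₀)) (⊕-identityˡ h)) (xor-same (Q h xor Q₀))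

  inRadical : Vec Bool n → Bool
  inRadical h = ∀ᵇ n (λ x → not (B h x))

  inRadical-sound : ∀ h → inRadical h ≡ true → ∀ x → B h x ≡ false
  inRadical-sound h h∈R x = not-true (∀ᵇ-sound n _ h∈R x)

  sum-sign-B : ∀ h → Σℤ.sum n (λ x → sign (B h x)) ≡ + (2 ℕ.^ n) ℤ.* + indicator (inRadical h)
  sum-sign-B h with inRadical h in h∈R
  ... | true = trans (sum-sign-false n (B h) (inRadical-sound h h∈R)) (sym (ℤP.*-identityʳ (+ (2 ℕ.^ n))))
  ... | false = let (x , Bhx) = ∀ᵇ-counterexample n _ h∈R in
                trans (sum-sign-additive n (B h) (B-additive h) x (not-false Bhx)) (sym (ℤP.*-zeroʳ (+ (2 ℕ.^ n))))
    where not-false : ∀ {b} → not b ≡ false → b ≡ true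
          not-false {true} _ = refl

  inRadical-zero : inRadical (0ⁿ n) ≡ true
  inRadical-zero = ∀ᵇ-complete n _ (λ x → cong not (trans (B-comm (0ⁿ n) x) (B-zero x)))

  inRadical-⊕ : ∀ h h′ → inRadical h ≡ true → inRadical h′ ≡ true → inRadical (h ⊕ h′) ≡ true
  inRadical-⊕ h h′ h∈R h′∈R = ∀ᵇ-complete n _ (λ x → cong not (begin
    B (h ⊕ h′) x          ≡⟨ B-comm (h ⊕ h′) x ⟩
    B x (h ⊕ h′)          ≡⟨ B-additive x h h′ ⟩
    B x h xor B x h′      ≡⟨ cong₂ _xor_ (trans (sym (B-comm h x)) (inRadical-sound h h∈R x)) (trans (sym (B-comm h′ x)) (inRadical-sound h′ h′∈R x)) ⟩
    false                 ∎))
    where open ≡-Reasoning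

  inRadical-translate : ∀ h h₀ → inRadical h₀ ≡ true → inRadical (h ⊕ h₀) ≡ inRadical h
  inRadical-translate h h₀ h₀∈R = bool-ext
    (λ h⊕h₀∈R → subst (λ z → inRadical z ≡ true) (⊕-cancelʳ h h₀) (inRadical-⊕ (h ⊕ h₀) h₀ h⊕h₀∈R h₀∈R))
    (λ h∈R → inRadical-⊕ h h₀ h∈R h₀∈R)

  phase : Vec Bool n → Vec Bool n → Bool
  phase A h = (Q h xor Q₀) xor xA A h

  phase-additive : ∀ A h h′ → inRadical h′ ≡ true → phase A (h ⊕ h′) ≡ phase A h xor phase A h′
  phase-additive A h h′ h′∈R = xor-by-false
    (trans (cong ((Q (h ⊕ h′) xor Q₀) xor_) (xA-additive A h h′))
      (by-truth-table 6
        (λ { (w ∷ p ∷ q ∷ z ∷ a ∷ b ∷ []) → (w xor z) xor (a xor b) })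
        (λ { (w ∷ p ∷ q ∷ z ∷ a ∷ b ∷ []) → (((p xor z) xor a) xor ((q xor z) xor b)) xor ((w xor p) xor (q xor z)) })
        refl (Q (h ⊕ h′) ∷ Q h ∷ Q h′ ∷ Q₀ ∷ xA A h ∷ xA A h′ ∷ [])))
    (inRadical-sound h′ h′∈R h)

  -- F A = 2ⁿ f̂(A) for f = (-1)^Q.
  F : Vec Bool n → ℤ
  F A = Σℤ.sum n (λ x → sign (Q x) ℤ.* sign (xA A x))

  radicalSum : Vec Bool n → ℤ
  radicalSum A = Σℤ.sum n (λ h → + indicator (inRadical h) ℤ.* sign (phase A h))

  F²≡2ⁿ*radicalSum : ∀ A → F A ℤ.* F A ≡ + (2 ℕ.^ n) ℤ.* radicalSum A
  F²≡2ⁿ*radicalSum A = begin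
    F A ℤ.* F A                                              ≡⟨ sum-product n g g ⟩
    Σℤ.sum n (λ x → Σℤ.sum n (λ y → g x ℤ.* g y))            ≡⟨ Σℤ.sum-cong n (λ x → sym (Σℤ.sum-translate n (λ y → g x ℤ.* g y) x)) ⟩
    Σℤ.sum n (λ x → Σℤ.sum n (λ h → g x ℤ.* g (h ⊕ x)))      ≡⟨ Σℤ.sum-cong n (λ x → Σℤ.sum-cong n (λ h → g-product x h)) ⟩
    Σℤ.sum n (λ x → Σℤ.sum n (λ h → sign (B h x) ℤ.* sign (phase A h))) ≡⟨ Σℤ.sum-swap n n (λ x h → sign (B h x) ℤ.* sign (phase A h)) ⟩
    Σℤ.sum n (λ h → Σℤ.sum n (λ x → sign (B h x) ℤ.* sign (phase A h))) ≡⟨ Σℤ.sum-cong n (λ h → sum-*ʳ n (sign (phase A h)) (λ x → sign (B h x))) ⟩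
    Σℤ.sum n (λ h → Σℤ.sum n (λ x → sign (B h x)) ℤ.* sign (phase A h)) ≡⟨ Σℤ.sum-cong n (λ h → trans (cong (ℤ._* sign (phase A h)) (sum-sign-B h))
                                                                            (ℤP.*-assoc (+ (2 ℕ.^ n)) (+ indicator (inRadical h)) (sign (phase A h)))) ⟩
    Σℤ.sum n (λ h → + (2 ℕ.^ n) ℤ.* (+ indicator (inRadical h) ℤ.* sign (phase A h))) ≡⟨ sum-*ˡ n (+ (2 ℕ.^ n)) _ ⟩
    + (2 ℕ.^ n) ℤ.* radicalSum A                             ∎
    where
      open ≡-Reasoning
      g = λ x → sign (Q x) ℤ.* sign (xA A x)
      g-product : ∀ x h → g x ℤ.* g (h ⊕ x) ≡ sign (B h x) ℤ.* sign (phase A h)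
      g-product x h = begin
        g x ℤ.* g (h ⊕ x)                                              ≡⟨ cong₂ ℤ._*_ (sign-xor (Q x) (xA A x)) (sign-xor (Q (h ⊕ x)) (xA A (h ⊕ x))) ⟨
        sign (Q x xor xA A x) ℤ.* sign (Q (h ⊕ x) xor xA A (h ⊕ x))    ≡⟨ sign-xor (Q x xor xA A x) (Q (h ⊕ x) xor xA A (h ⊕ x)) ⟨
        sign ((Q x xor xA A x) xor (Q (h ⊕ x) xor xA A (h ⊕ x)))       ≡⟨ cong₂ (λ u v → sign ((Q x xor xA A x) xor (Q u xor v))) (⊕-comm h x) (xA-additive A h x) ⟩
        sign ((Q x xor xA A x) xor (Q (x ⊕ h) xor (xA A h xor xA A x))) ≡⟨ cong sign (by-truth-table 6
                 (λ { (qx ∷ ax ∷ qxh ∷ ah ∷ qh ∷ q₀ ∷ []) → (qx xor ax) xor (qxh xor (ah xor ax)) })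
                 (λ { (qx ∷ ax ∷ qxh ∷ ah ∷ qh ∷ q₀ ∷ []) → ((qxh xor qx) xor (qh xor q₀)) xor ((qh xor q₀) xor ah) })
                 refl (Q x ∷ xA A x ∷ Q (x ⊕ h) ∷ xA A h ∷ Q h ∷ Q₀ ∷ [])) ⟩
        sign (B h x xor phase A h)                                     ≡⟨ sign-xor (B h x) (phase A h) ⟩
        sign (B h x) ℤ.* sign (phase A h)                              ∎

  inSupport : Vec Bool n → Bool
  inSupport A = ∀ᵇ n (λ h → not (inRadical h) ∨ not (phase A h))

  inSupport-phase : ∀ A h → inSupport A ≡ true → inRadical h ≡ true → phase A h ≡ false
  inSupport-phase A h A∈S h∈R = not-true (subst (λ b → not b ∨ not (phase A h) ≡ true) h∈R (∀ᵇ-sound n _ A∈S h))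

  radicalSum-inSupport : ∀ A → inSupport A ≡ true → radicalSum A ≡ + count n inRadical
  radicalSum-inSupport A A∈S = trans (Σℤ.sum-cong n term) (sum-ℕ n (λ h → indicator (inRadical h)))
    where
      term : ∀ h → + indicator (inRadical h) ℤ.* sign (phase A h) ≡ + indicator (inRadical h)
      term h with inRadical h in h∈R
      ... | true = cong (λ b → + 1 ℤ.* sign b) (inSupport-phase A h A∈S h∈R)
      ... | false = refl

  -- Off the support some h₀ ∈ R has phase 1, and translating by h₀ negates the radical sum.
  radicalSum-offSupport : ∀ A → inSupport A ≡ false → radicalSum A ≡ + 0
  radicalSum-offSupport A A∉S = s≡-s⇒s≡0 (radicalSum A) (begin
    radicalSum A                 ≡⟨ Σℤ.sum-translate n g h₀ ⟨
    Σℤ.sum n (λ h → g (h ⊕ h₀))  ≡⟨ Σℤ.sum-cong n negated ⟩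
    Σℤ.sum n (λ h → - g h)       ≡⟨ sum-neg n g ⟩
    - radicalSum A               ∎)
    where
      open ≡-Reasoning
      g = λ h → + indicator (inRadical h) ℤ.* sign (phase A h)
      witness = ∀ᵇ-counterexample n _ A∉S
      h₀ = proj₁ witness
      h₀∈R : inRadical h₀ ≡ true
      h₀∈R with inRadical h₀ | proj₂ witness
      ... | true | _ = refl
      phase-h₀ : phase A h₀ ≡ true
      phase-h₀ with inRadical h₀ | phase A h₀ | proj₂ witness
      ... | true | true | _ = refl
      negated : ∀ h → g (h ⊕ h₀) ≡ - g h
      negated h rewrite inRadical-translate h h₀ h₀∈R with inRadical h in h∈R
      ... | true = begin
        + 1 ℤ.* sign (phase A (h ⊕ h₀))     ≡⟨ ℤP.*-identityˡ _ ⟩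
        sign (phase A (h ⊕ h₀))             ≡⟨ cong sign (trans (phase-additive A h h₀ h₀∈R) (cong (phase A h xor_) phase-h₀)) ⟩
        sign (phase A h xor true)           ≡⟨ sign-xor (phase A h) true ⟩
        sign (phase A h) ℤ.* - + 1          ≡⟨ ℤP.*-comm (sign (phase A h)) (- + 1) ⟩
        - + 1 ℤ.* sign (phase A h)          ≡⟨ ℤP.neg-distribˡ-* (+ 1) (sign (phase A h)) ⟨
        - (+ 1 ℤ.* sign (phase A h))        ∎
      ... | false = refl

  radicalSum≡ : ∀ A → radicalSum A ≡ + indicator (inSupport A) ℤ.* + count n inRadical
  radicalSum≡ A with inSupport A in A∈S
  ... | true = trans (radicalSum-inSupport A A∈S) (sym (ℤP.*-identityˡ _))
  ... | false = radicalSum-offSupport A A∈S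

  -- Parseval: Σ_A F(A)² = 4ⁿ.
  sum-radicalSum : Σℤ.sum n radicalSum ≡ + (2 ℕ.^ n)
  sum-radicalSum = begin
    Σℤ.sum n radicalSum                                                         ≡⟨ Σℤ.sum-swap n n (λ A h → + indicator (inRadical h) ℤ.* sign (phase A h)) ⟩
    Σℤ.sum n (λ h → Σℤ.sum n (λ A → + indicator (inRadical h) ℤ.* sign (phase A h))) ≡⟨ Σℤ.sum-cong n inner ⟩
    Σℤ.sum n (λ h → + indicator (isZero h) ℤ.* (c h ℤ.* + (2 ℕ.^ n)))           ≡⟨ sum-at-zero n (λ h → c h ℤ.* + (2 ℕ.^ n)) ⟩
    c (0ⁿ n) ℤ.* + (2 ℕ.^ n)                                                    ≡⟨ cong₂ (λ a b → (+ indicator a ℤ.* sign b) ℤ.* + (2 ℕ.^ n)) inRadical-zero (xor-same Q₀) ⟩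
    (+ 1 ℤ.* + 1) ℤ.* + (2 ℕ.^ n)                                               ≡⟨ ℤP.*-identityˡ _ ⟩
    + (2 ℕ.^ n)                                                                 ∎
    where
      open ≡-Reasoning
      c = λ h → + indicator (inRadical h) ℤ.* sign (Q h xor Q₀)
      rearrange : ∀ a b d → a ℤ.* (b ℤ.* d) ≡ d ℤ.* (a ℤ.* b)
      rearrange = solve-∀
      inner : ∀ h → Σℤ.sum n (λ A → + indicator (inRadical h) ℤ.* sign (phase A h)) ≡ + indicator (isZero h) ℤ.* (c h ℤ.* + (2 ℕ.^ n))
      inner h = begin
        Σℤ.sum n (λ A → + indicator (inRadical h) ℤ.* sign (phase A h))
          ≡⟨ Σℤ.sum-cong n (λ A → trans (cong (+ indicator (inRadical h) ℤ.*_) (sign-xor (Q h xor Q₀) (xA A h)))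
                                        (sym (ℤP.*-assoc (+ indicator (inRadical h)) (sign (Q h xor Q₀)) (sign (xA A h))))) ⟩
        Σℤ.sum n (λ A → c h ℤ.* sign (xA A h))                  ≡⟨ sum-*ˡ n (c h) (λ A → sign (xA A h)) ⟩
        c h ℤ.* Σℤ.sum n (λ A → sign (xA A h))                  ≡⟨ cong (c h ℤ.*_) (sum-sign-xA n h) ⟩
        c h ℤ.* (+ (2 ℕ.^ n) ℤ.* + indicator (isZero h))        ≡⟨ rearrange (c h) (+ (2 ℕ.^ n)) (+ indicator (isZero h)) ⟩
        + indicator (isZero h) ℤ.* (c h ℤ.* + (2 ℕ.^ n))        ∎

  support×radical : count n inSupport ℕ.* count n inRadical ≡ 2 ℕ.^ n
  support×radical = ℤP.+-injective (begin
    + (count n inSupport ℕ.* count n inRadical)                        ≡⟨ ℤP.pos-* (count n inSupport) (count n inRadical) ⟩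
    + count n inSupport ℤ.* + count n inRadical                        ≡⟨ cong (ℤ._* + count n inRadical) (sum-ℕ n (λ A → indicator (inSupport A))) ⟨
    Σℤ.sum n (λ A → + indicator (inSupport A)) ℤ.* + count n inRadical ≡⟨ sum-*ʳ n (+ count n inRadical) (λ A → + indicator (inSupport A)) ⟨
    Σℤ.sum n (λ A → + indicator (inSupport A) ℤ.* + count n inRadical) ≡⟨ Σℤ.sum-cong n radicalSum≡ ⟨
    Σℤ.sum n radicalSum                                                ≡⟨ sum-radicalSum ⟩
    + (2 ℕ.^ n)                                                        ∎)
    where open ≡-Reasoning

  support-affine : Affine inSupport
  support-affine A A′ A″ A∈S A′∈S A″∈S = ∀ᵇ-complete n _ vanishes
    where
      xA-additiveˡ : ∀ (A A′ h : Vec Bool n) → xA (A ⊕ A′) h ≡ xA A h xor xA A′ h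
      xA-additiveˡ A A′ h = trans (xA-comm (A ⊕ A′) h) (trans (xA-additive h A A′) (cong₂ _xor_ (sym (xA-comm A h)) (sym (xA-comm A′ h))))
      vanishes : ∀ h → not (inRadical h) ∨ not (phase (A ⊕ A′ ⊕ A″) h) ≡ true
      vanishes h with inRadical h in h∈R
      ... | false = refl
      ... | true = cong not (begin
        (Q h xor Q₀) xor xA (A ⊕ A′ ⊕ A″) h
          ≡⟨ cong ((Q h xor Q₀) xor_) (trans (xA-additiveˡ (A ⊕ A′) A″ h) (cong (_xor xA A″ h) (xA-additiveˡ A A′ h))) ⟩
        (Q h xor Q₀) xor ((xA A h xor xA A′ h) xor xA A″ h)
          ≡⟨ by-truth-table 4
               (λ { (q ∷ a ∷ b ∷ c ∷ []) → q xor ((a xor b) xor c) })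
               (λ { (q ∷ a ∷ b ∷ c ∷ []) → ((q xor a) xor (q xor b)) xor (q xor c) })
               refl ((Q h xor Q₀) ∷ xA A h ∷ xA A′ h ∷ xA A″ h ∷ []) ⟩
        (phase A h xor phase A′ h) xor phase A″ h
          ≡⟨ cong₂ (λ u v → (u xor v) xor phase A″ h) (inSupport-phase A h A∈S h∈R) (inSupport-phase A′ h A′∈S h∈R) ⟩
        phase A″ h
          ≡⟨ inSupport-phase A″ h A″∈S h∈R ⟩
        false ∎)
        where open ≡-Reasoning

  F²≡ : ∀ A → F A ℤ.* F A ≡ + (2 ℕ.^ n) ℤ.* (+ indicator (inSupport A) ℤ.* + count n inRadical)
  F²≡ A = trans (F²≡2ⁿ*radicalSum A) (cong (+ (2 ℕ.^ n) ℤ.*_) (radicalSum≡ A))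

module Fractions where

  open import Data.Nat as ℕ using (ℕ; suc)
  open import Data.Integer as ℤ using (ℤ; +_)
  import Data.Integer.Properties as ℤP
  open import Data.Integer.Tactic.RingSolver using (solve-∀)
  open import Data.Rational as ℚ using (ℚ; _/_; 0ℚ; toℚᵘ; _+_; _*_; _-_; ∣_∣; _≤_)
  import Data.Rational.Properties as ℚP
  import Data.Rational.Unnormalised as ℚᵘ
  import Data.Rational.Unnormalised.Properties as ℚᵘP
  open import Data.List using ([]; _∷_; map)
  open import Data.Nat.ListAction using (sum)
  open import Defs using (sumℚ)

  toℚᵘ-/ : ∀ i d → toℚᵘ (i / suc d) ℚᵘ.≃ ℚᵘ.mkℚᵘ i d
  toℚᵘ-/ i d = ℚP.toℚᵘ-fromℚᵘ (ℚᵘ.mkℚᵘ i d)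

  /-+ : ∀ a b d → (+ a) / suc d + (+ b) / suc d ≡ (+ (a ℕ.+ b)) / suc d
  /-+ a b d = ℚP.toℚᵘ-injective (ℚᵘP.≃-trans (ℚP.toℚᵘ-homo-+ ((+ a) / suc d) ((+ b) / suc d))
                (ℚᵘP.≃-trans (ℚᵘP.+-cong (toℚᵘ-/ (+ a) d) (toℚᵘ-/ (+ b) d))
                  (ℚᵘP.≃-trans (ℚᵘ.*≡* cross) (ℚᵘP.≃-sym (toℚᵘ-/ (+ (a ℕ.+ b)) d)))))
    where
      common : ∀ A B S → (A ℤ.* S ℤ.+ B ℤ.* S) ℤ.* S ≡ (A ℤ.+ B) ℤ.* (S ℤ.* S)
      common = solve-∀
      cross : ((+ a) ℤ.* (+ suc d) ℤ.+ (+ b) ℤ.* (+ suc d)) ℤ.* (+ suc d) ≡ (+ (a ℕ.+ b)) ℤ.* (+ (suc d ℕ.* suc d))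
      cross = trans (common (+ a) (+ b) (+ suc d)) (cong₂ ℤ._*_ (sym (ℤP.pos-+ a b)) (sym (ℤP.pos-* (suc d) (suc d))))

  /-* : ∀ i j d e → (i / suc d) * (j / suc e) ≡ (i ℤ.* j) / (suc d ℕ.* suc e)
  /-* i j d e = ℚP.toℚᵘ-injective (ℚᵘP.≃-trans (ℚP.toℚᵘ-homo-* (i / suc d) (j / suc e))
                  (ℚᵘP.≃-trans (ℚᵘP.*-cong (toℚᵘ-/ i d) (toℚᵘ-/ j e)) (ℚᵘP.≃-sym (toℚᵘ-/ (i ℤ.* j) (e ℕ.+ d ℕ.* suc e)))))

  ∣/∣ : ∀ i d → ∣ i / suc d ∣ ≡ (+ ℤ.∣ i ∣) / suc d
  ∣/∣ i d = ℚP.toℚᵘ-injective (ℚᵘP.≃-trans (ℚP.toℚᵘ-homo-∣-∣ (i / suc d))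
              (ℚᵘP.≃-trans (ℚᵘP.∣-∣-cong (toℚᵘ-/ i d)) (ℚᵘP.≃-sym (toℚᵘ-/ (+ ℤ.∣ i ∣) d))))

  /-≤ : ∀ a b d e → a ℕ.* suc e ℕ.≤ b ℕ.* suc d → (+ a) / suc d ≤ (+ b) / suc e
  /-≤ a b d e h = ℚP.toℚᵘ-cancel-≤ (ℚᵘP.≤-respˡ-≃ (ℚᵘP.≃-sym (toℚᵘ-/ (+ a) d)) (ℚᵘP.≤-respʳ-≃ (ℚᵘP.≃-sym (toℚᵘ-/ (+ b) e))
                    (ℚᵘ.*≤* (subst₂ ℤ._≤_ (ℤP.pos-* a (suc e)) (ℤP.pos-* b (suc d)) (ℤ.+≤+ h)))))

  0≤/ : ∀ a d → 0ℚ ≤ (+ a) / suc d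
  0≤/ a d = /-≤ 0 a 0 d ℕ.z≤n

  p≤q⇒0≤q-p : ∀ {p q} → p ≤ q → 0ℚ ≤ q - p
  p≤q⇒0≤q-p {p} {q} p≤q = subst (_≤ q - p) (ℚP.+-inverseʳ p) (ℚP.+-monoˡ-≤ (ℚ.- p) p≤q)

  sumℚ-/ : ∀ {A : Set} (g : A → ℚ) (h : A → ℕ) d → (∀ x → g x ≡ (+ h x) / suc d) →
    ∀ xs → sumℚ (map g xs) ≡ (+ sum (map h xs)) / suc d
  sumℚ-/ g h d g≡ [] = sym (ℚP.0/n≡0 (suc d))
  sumℚ-/ g h d g≡ (x ∷ xs) = trans (cong₂ _+_ (g≡ x) (sumℚ-/ g h d g≡ xs)) (/-+ (h x) _ d)

module LevelSums where

  open import Data.Bool using (Bool; true; false; _∧_; if_then_else_)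
  open import Data.Bool.Properties using (∧-zeroʳ; ∧-identityʳ)
  open import Data.Nat as ℕ using (ℕ; zero; suc; _+_; _*_)
  import Data.Nat.Properties as ℕP
  open import Data.Nat.ListAction using (sum)
  open import Data.Fin.Subset using (∣_∣)
  open import Data.List using ([]; _∷_; map; filter)
  open import Data.Vec using (Vec; _∷_)
  open import Relation.Nullary using (Dec; does)
  open import Defs using (allVecs; subsetsOfSize)
  open AffineSubspaces using (indicator; countOfWeight; module Σℕ)

  sum-filter : ∀ {A : Set} {P : A → Set} (P? : ∀ x → Dec (P x)) (h : A → ℕ) xs →
    sum (map h (filter P? xs)) ≡ sum (map (λ x → if does (P? x) then h x else 0) xs)
  sum-filter P? h [] = refl
  sum-filter P? h (x ∷ xs) with does (P? x)
  ... | true = cong (h x +_) (sum-filter P? h xs)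
  ... | false = sum-filter P? h xs

  sum-*ʳ : ∀ n (f : Vec Bool n → ℕ) c → Σℕ.sum n (λ x → f x * c) ≡ Σℕ.sum n f * c
  sum-*ʳ zero f c = refl
  sum-*ʳ (suc n) f c =
    trans (cong₂ _+_ (sum-*ʳ n (λ x → f (false ∷ x)) c) (sum-*ʳ n (λ x → f (true ∷ x)) c))
          (sym (ℕP.*-distribʳ-+ c (Σℕ.sum n (λ x → f (false ∷ x))) (Σℕ.sum n (λ x → f (true ∷ x)))))

  level-sum : ∀ n k (S : Vec Bool n → Bool) M →
    sum (map (λ A → indicator (S A) * M) (subsetsOfSize n k)) ≡ countOfWeight n S k * M
  level-sum n k S M = begin
    sum (map (λ A → indicator (S A) * M) (filter (λ A → ∣ A ∣ ℕP.≟ k) (allVecs n)))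
      ≡⟨ sum-filter (λ A → ∣ A ∣ ℕP.≟ k) _ (allVecs n) ⟩
    sum (map (λ A → if ∣ A ∣ ℕ.≡ᵇ k then indicator (S A) * M else 0) (allVecs n))
      ≡⟨ Σℕ.foldr-allVecs n _ ⟩
    Σℕ.sum n (λ A → if ∣ A ∣ ℕ.≡ᵇ k then indicator (S A) * M else 0)
      ≡⟨ Σℕ.sum-cong n restrict ⟩
    Σℕ.sum n (λ A → indicator (S A ∧ (∣ A ∣ ℕ.≡ᵇ k)) * M)
      ≡⟨ sum-*ʳ n _ M ⟩
    countOfWeight n S k * M ∎
    where
      open ≡-Reasoning
      restrict : ∀ A → (if ∣ A ∣ ℕ.≡ᵇ k then indicator (S A) * M else 0) ≡ indicator (S A ∧ (∣ A ∣ ℕ.≡ᵇ k)) * M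
      restrict A with ∣ A ∣ ℕ.≡ᵇ k
      ... | true = cong (λ b → indicator b * M) (sym (∧-identityʳ (S A)))
      ... | false = cong (λ b → indicator b * M) (sym (∧-zeroʳ (S A)))

module LevelEstimate (n k : ℕ) (p : Vec Bool n → Bool) (quadratic : DegreeAtMost2 p) where

  open import Data.Bool using (true; false)
  open import Data.Nat as ℕ using (zero; suc; _≤_)
  import Data.Nat.Properties as ℕP
  open import Data.Nat.Tactic.RingSolver using (solve-∀)
  open import Data.Empty using (⊥-elim)
  open import Data.Integer as ℤ using (ℤ; +_)
  import Data.Integer.Properties as ℤP
  open import Data.Rational as ℚ using (ℚ; _/_)
  open import Data.Product using (Σ; _,_; proj₁; proj₂)
  open import Relation.Binary.Definitions using (tri<; tri≈; tri>)
  open import Defs using (fourierSign; levelL1; xA; sign)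
  open SilverRatio using (silverRe)
  open BallEstimate using (ball-square-bound)
  open AffineSubspaces
  open Characters using (module Σℤ)
  open QuadraticSpectrum p (ThirdDifference.Δ³-degree≤2 p quadratic)
  open Fractions

  private
    R = count n inRadical

    m*m≡n*n⇒m≡n : ∀ a b → a ℕ.* a ≡ b ℕ.* b → a ≡ b
    m*m≡n*n⇒m≡n a b eq with ℕP.<-cmp a b
    ... | tri< a<b _ _ = ⊥-elim (ℕP.<-irrefl eq (ℕP.*-mono-< a<b a<b))
    ... | tri≈ _ a≡b _ = a≡b
    ... | tri> _ _ a>b = ⊥-elim (ℕP.<-irrefl (sym eq) (ℕP.*-mono-< a>b a>b))

    m*m≡0⇒m≡0 : ∀ a → a ℕ.* a ≡ 0 → a ≡ 0
    m*m≡0⇒m≡0 zero _ = refl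

    support-nonempty : 1 ≤ count n inSupport
    support-nonempty with count n inSupport in c≡
    ... | zero = ⊥-elim (ℕP.<-irrefl (trans (cong (ℕ._* R) (sym c≡)) support×radical) (ℕP.m^n>0 2 n))
    ... | suc _ = ℕ.s≤s ℕ.z≤n

    A₀ = count-witness n inSupport support-nonempty
    M = ℤ.∣ F (proj₁ A₀) ∣

    ∣F∣² : ∀ A → ℤ.∣ F A ∣ ℕ.* ℤ.∣ F A ∣ ≡ 2 ℕ.^ n ℕ.* (indicator (inSupport A) ℕ.* R)
    ∣F∣² A = trans (sym (ℤP.abs-* (F A) (F A))) (trans (cong ℤ.∣_∣ (F²≡ A))
               (trans (ℤP.abs-* (+ (2 ℕ.^ n)) (+ indicator (inSupport A) ℤ.* + R))
                      (cong (2 ℕ.^ n ℕ.*_) (ℤP.abs-* (+ indicator (inSupport A)) (+ R)))))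

    M² : M ℕ.* M ≡ 2 ℕ.^ n ℕ.* R
    M² = trans (∣F∣² (proj₁ A₀)) (trans (cong (λ b → 2 ℕ.^ n ℕ.* (indicator b ℕ.* R)) (proj₂ A₀))
                                        (cong (2 ℕ.^ n ℕ.*_) (ℕP.*-identityˡ R)))

    ∣F∣≡ : ∀ A → ℤ.∣ F A ∣ ≡ indicator (inSupport A) ℕ.* M
    ∣F∣≡ A with inSupport A in A∈S
    ... | true = trans (m*m≡n*n⇒m≡n _ _ (trans (∣F∣² A) (trans (cong (λ b → 2 ℕ.^ n ℕ.* (indicator b ℕ.* R)) A∈S)
                                          (trans (cong (2 ℕ.^ n ℕ.*_) (ℕP.*-identityˡ R)) (sym M²)))))
                       (sym (ℕP.*-identityˡ M))
    ... | false = m*m≡0⇒m≡0 _ (trans (∣F∣² A) (trans (cong (λ b → 2 ℕ.^ n ℕ.* (indicator b ℕ.* R)) A∈S) (ℕP.*-zeroʳ (2 ℕ.^ n))))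

    2ⁿ-1 : Σ ℕ λ d → 2 ℕ.^ n ≡ suc d
    2ⁿ-1 with 2 ℕ.^ n in eq
    ... | zero = ⊥-elim (ℕP.<-irrefl (sym eq) (ℕP.m^n>0 2 n))
    ... | suc d = d , refl

    d = proj₁ 2ⁿ-1

    fourierSign≡ : ∀ A → fourierSign n p A ≡ F A / suc d
    fourierSign≡ A = trans (cong (λ z → (z / 2 ℕ.^ n) {{ℕP.m^n≢0 2 n}}) (Σℤ.foldr-allVecs n (λ x → sign (p x) ℤ.* sign (xA A x))))
                           (same-denominator (F A) {{ℕP.m^n≢0 2 n}} (proj₂ 2ⁿ-1))
      where
        same-denominator : ∀ i {D} .{{_ : ℕ.NonZero D}} → D ≡ suc d → i / D ≡ i / suc d
        same-denominator i refl = refl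

    N = countOfWeight n inSupport k

    levelL1≡ : levelL1 n k p ≡ (+ (N ℕ.* M)) / suc d
    levelL1≡ = trans (sumℚ-/ (λ A → ℚ.∣ fourierSign n p A ∣) (λ A → indicator (inSupport A) ℕ.* M) d
                        (λ A → trans (cong ℚ.∣_∣ (fourierSign≡ A)) (trans (∣/∣ (F A) d) (cong (λ z → (+ z) / suc d) (∣F∣≡ A))))
                        (Defs.subsetsOfSize n k))
                     (cong (λ z → (+ z) / suc d) (LevelSums.level-sum n k inSupport M))

    level² : levelL1 n k p ℚ.* levelL1 n k p ℚ.* ((+ k) / 1) ≡ (+ (N ℕ.* M ℕ.* (N ℕ.* M) ℕ.* k)) / (suc d ℕ.* suc d ℕ.* 1)
    level² = begin
      levelL1 n k p ℚ.* levelL1 n k p ℚ.* ((+ k) / 1)                 ≡⟨ cong (λ z → z ℚ.* z ℚ.* ((+ k) / 1)) levelL1≡ ⟩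
      ((+ (N ℕ.* M)) / suc d) ℚ.* ((+ (N ℕ.* M)) / suc d) ℚ.* ((+ k) / 1) ≡⟨ cong (ℚ._* ((+ k) / 1)) (/-* (+ (N ℕ.* M)) (+ (N ℕ.* M)) d d) ⟩
      ((+ (N ℕ.* M) ℤ.* + (N ℕ.* M)) / (suc d ℕ.* suc d)) ℚ.* ((+ k) / 1) ≡⟨ /-* (+ (N ℕ.* M) ℤ.* + (N ℕ.* M)) (+ k) (d ℕ.+ d ℕ.* suc d) 0 ⟩
      ((+ (N ℕ.* M) ℤ.* + (N ℕ.* M)) ℤ.* + k) / (suc d ℕ.* suc d ℕ.* 1) ≡⟨ cong (λ z → (z ℤ.* + k) / (suc d ℕ.* suc d ℕ.* 1)) (ℤP.pos-* (N ℕ.* M) (N ℕ.* M)) ⟨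
      (+ (N ℕ.* M ℕ.* (N ℕ.* M)) ℤ.* + k) / (suc d ℕ.* suc d ℕ.* 1)     ≡⟨ cong (_/ (suc d ℕ.* suc d ℕ.* 1)) (ℤP.pos-* (N ℕ.* M ℕ.* (N ℕ.* M)) k) ⟨
      (+ (N ℕ.* M ℕ.* (N ℕ.* M) ℕ.* k)) / (suc d ℕ.* suc d ℕ.* 1)      ∎
      where open ≡-Reasoning

    -- With |S| = 2^r and |S| |R| = 2ⁿ: k L² = k N² M² / 4ⁿ = k N² / 2^r.
    kN²M²-bound : 1 ≤ k → N ℕ.* M ℕ.* (N ℕ.* M) ℕ.* k ℕ.* 1 ≤ 74 ℕ.* 74 ℕ.* silverRe (2 ℕ.* k) ℕ.* (suc d ℕ.* suc d ℕ.* 1)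
    kN²M²-bound 1≤k = begin
      N ℕ.* M ℕ.* (N ℕ.* M) ℕ.* k ℕ.* 1           ≡⟨ e₁ N M k ⟩
      (k ℕ.* (N ℕ.* N)) ℕ.* (M ℕ.* M)             ≡⟨ cong ((k ℕ.* (N ℕ.* N)) ℕ.*_) M² ⟩
      (k ℕ.* (N ℕ.* N)) ℕ.* (2 ℕ.^ n ℕ.* R)       ≤⟨ ℕP.*-monoˡ-≤ (2 ℕ.^ n ℕ.* R) (ball-square-bound r k N 1≤k (proj₂ (proj₂ counted) k)) ⟩
      (P ℕ.* 2 ℕ.^ r) ℕ.* (2 ℕ.^ n ℕ.* R)         ≡⟨ e₂ P (2 ℕ.^ r) (2 ℕ.^ n) R ⟩
      P ℕ.* (2 ℕ.^ n ℕ.* (2 ℕ.^ r ℕ.* R))         ≡⟨ cong (λ z → P ℕ.* (2 ℕ.^ n ℕ.* z)) 2^r*R≡2ⁿ ⟩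
      P ℕ.* (2 ℕ.^ n ℕ.* 2 ℕ.^ n)                 ≡⟨ cong (P ℕ.*_) (trans (cong₂ ℕ._*_ (proj₂ 2ⁿ-1) (proj₂ 2ⁿ-1)) (sym (ℕP.*-identityʳ _))) ⟩
      P ℕ.* (suc d ℕ.* suc d ℕ.* 1)               ≡⟨ cong (λ z → 74 ℕ.* 74 ℕ.* silverRe z ℕ.* (suc d ℕ.* suc d ℕ.* 1)) (cong (k ℕ.+_) (sym (ℕP.+-identityʳ k))) ⟩
      74 ℕ.* 74 ℕ.* silverRe (2 ℕ.* k) ℕ.* (suc d ℕ.* suc d ℕ.* 1) ∎
      where
        open ℕP.≤-Reasoning
        P = 74 ℕ.* 74 ℕ.* silverRe (k ℕ.+ k)
        counted = affine-count n inSupport support-affine A₀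
        r = proj₁ counted
        2^r*R≡2ⁿ : 2 ℕ.^ r ℕ.* R ≡ 2 ℕ.^ n
        2^r*R≡2ⁿ = trans (cong (ℕ._* R) (sym (proj₁ (proj₂ counted)))) support×radical
        e₁ : ∀ N M k → N ℕ.* M ℕ.* (N ℕ.* M) ℕ.* k ℕ.* 1 ≡ (k ℕ.* (N ℕ.* N)) ℕ.* (M ℕ.* M)
        e₁ = solve-∀
        e₂ : ∀ P a b R → (P ℕ.* a) ℕ.* (b ℕ.* R) ≡ P ℕ.* (b ℕ.* (a ℕ.* R))
        e₂ = solve-∀

  level-bound : 1 ≤ k → levelL1 n k p ℚ.* levelL1 n k p ℚ.* ((+ k) / 1) ℚ.≤ (+ (74 ℕ.* 74 ℕ.* silverRe (2 ℕ.* k))) / 1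
  level-bound 1≤k = subst (ℚ._≤ (+ (74 ℕ.* 74 ℕ.* silverRe (2 ℕ.* k))) / 1) (sym level²)
                      (/-≤ (N ℕ.* M ℕ.* (N ℕ.* M) ℕ.* k) (74 ℕ.* 74 ℕ.* silverRe (2 ℕ.* k)) ((d ℕ.+ d ℕ.* suc d) ℕ.* 1) 0 (kN²M²-bound 1≤k))

module RealQuadraticField where

  open import Data.Nat as ℕ using (zero; suc)
  import Data.Nat.Properties as ℕP
  open import Data.Integer as ℤ using (+_)
  import Data.Integer.Properties as ℤP
  open import Data.Rational as ℚ using (ℚ; _/_; 0ℚ; 1ℚ; _≤_)
  import Data.Rational.Properties as ℚP
  open import Data.Sum using (inj₁)
  open import Data.Product using (_,_)
  open import Defs using (_+_√2; fromℚ; _⊗_; _⊗^_; silver; two; _≤√2_)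
  open SilverRatio using (silverRe; silverIr)
  open Fractions

  ≤√2-rational : ∀ {q r s} → q ≤ r → 0ℚ ≤ s → fromℚ q ≤√2 (r + s √2)
  ≤√2-rational q≤r 0≤s = inj₁ (p≤q⇒0≤q-p q≤r , p≤q⇒0≤q-p 0≤s)

  ℕ/1-* : ∀ a b → ((+ a) / 1) ℚ.* ((+ b) / 1) ≡ (+ (a ℕ.* b)) / 1
  ℕ/1-* a b = trans (/-* (+ a) (+ b) 0 0) (cong (_/ 1) (sym (ℤP.pos-* a b)))

  silver-^ : ∀ m → silver ⊗^ m ≡ ((+ silverRe m) / 1) + ((+ silverIr m) / 1) √2
  silver-^ zero = refl
  silver-^ (suc m) rewrite silver-^ m = cong₂ _+_√2 re ir
    where
      P = (+ silverRe m) / 1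
      Q = (+ silverIr m) / 1
      re : 1ℚ ℚ.* P ℚ.+ two ℚ.* (1ℚ ℚ.* Q) ≡ (+ silverRe (suc m)) / 1
      re = trans (cong₂ ℚ._+_ (ℚP.*-identityˡ P) (trans (cong (two ℚ.*_) (ℚP.*-identityˡ Q)) (ℕ/1-* 2 (silverIr m))))
                 (/-+ (silverRe m) (2 ℕ.* silverIr m) 0)
      ir : 1ℚ ℚ.* Q ℚ.+ 1ℚ ℚ.* P ≡ (+ silverIr (suc m)) / 1
      ir = trans (cong₂ ℚ._+_ (ℚP.*-identityˡ Q) (ℚP.*-identityˡ P))
                 (trans (/-+ (silverIr m) (silverRe m) 0) (cong (λ z → (+ z) / 1) (ℕP.+-comm (silverIr m) (silverRe m))))

  scaled-silver-^ : ∀ c m → fromℚ (((+ c) / 1) ℚ.* ((+ c) / 1)) ⊗ (silver ⊗^ m)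
                            ≡ ((+ (c ℕ.* c ℕ.* silverRe m)) / 1) + ((+ (c ℕ.* c ℕ.* silverIr m)) / 1) √2
  scaled-silver-^ c m rewrite silver-^ m | ℕ/1-* c c = cong₂ _+_√2 re ir
    where
      re : (+ (c ℕ.* c)) / 1 ℚ.* ((+ silverRe m) / 1) ℚ.+ two ℚ.* (0ℚ ℚ.* ((+ silverIr m) / 1)) ≡ (+ (c ℕ.* c ℕ.* silverRe m)) / 1
      re = trans (cong₂ ℚ._+_ (ℕ/1-* (c ℕ.* c) (silverRe m)) (trans (cong (two ℚ.*_) (ℚP.*-zeroˡ ((+ silverIr m) / 1))) (ℚP.*-zeroʳ two)))
                 (ℚP.+-identityʳ ((+ (c ℕ.* c ℕ.* silverRe m)) / 1))
      ir : (+ (c ℕ.* c)) / 1 ℚ.* ((+ silverIr m) / 1) ℚ.+ 0ℚ ℚ.* ((+ silverRe m) / 1) ≡ (+ (c ℕ.* c ℕ.* silverIr m)) / 1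
      ir = trans (cong₂ ℚ._+_ (ℕ/1-* (c ℕ.* c) (silverIr m)) (ℚP.*-zeroˡ ((+ silverRe m) / 1))) (ℚP.+-identityʳ ((+ (c ℕ.* c ℕ.* silverIr m)) / 1))

  bound-by-rational-part : ∀ q c m → q ≤ (+ (c ℕ.* c ℕ.* silverRe m)) / 1 →
    fromℚ q ≤√2 (fromℚ (((+ c) / 1) ℚ.* ((+ c) / 1)) ⊗ (silver ⊗^ m))
  bound-by-rational-part q c m q≤ = subst (fromℚ q ≤√2_) (sym (scaled-silver-^ c m)) (≤√2-rational q≤ (0≤/ (c ℕ.* c ℕ.* silverIr m) 0))

open import Data.Nat using (_≤_)
open import Data.Integer using (+_)
open import Data.Rational using (ℚ; 0ℚ; _<_; _*_; _/_)
import Data.Rational.Properties as ℚP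
open import Data.Product using (Σ; _×_; _,_)
open import Defs using (levelL1; fromℚ; _≤√2_; _⊗_; _⊗^_; silver)

mainTheorem2 : Σ ℚ λ C → 0ℚ < C ×
  ((n k : ℕ) → 1 ≤ n → 1 ≤ k →
   (p : Vec Bool n → Bool) → DegreeAtMost2 p →
   fromℚ (levelL1 n k p * levelL1 n k p * ((+ k) / 1))
     ≤√2 (fromℚ (C * C) ⊗ (silver ⊗^ (2 Data.Nat.* k))))
mainTheorem2 = (+ 74) / 1 , ℚP.positive⁻¹ ((+ 74) / 1) , λ n k _ 1≤k p quadratic →
  RealQuadraticField.bound-by-rational-part _ 74 (2 Data.Nat.* k) (LevelEstimate.level-bound n k p quadratic 1≤k)
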